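{- Let $G=(V,E)$ be a finite connected graph with $|V|=n$, and let $\pi$ be a uniformly random bijection $V\to\{1,\dots,n\}$. For $v\in V$ let $B_v$ be the event that $\pi(v)\neq 1$ and $\pi(v)<\pi(u)$ for every neighbour $u$ of $v$, and let $G_v$ be the complementary event (i.e. $\pi(v)=1$ or some neighbour $u$ of $v$ has $\pi(u)<\pi(v)$). For $J\subseteq V$ put $B_J=\bigcap_{v\in J}B_v$ and $G_J=\bigcap_{v\in J}G_v$ (empty intersections being the whole space). Then for every independent set $J\subseteq V$, $$\Pr(B_J)=\frac{a(J)\,b(J)}{n}=\sum_{T\subseteq J}(-1)^{|T|}\Pr(G_T),$$ where $a(J)=n-|J|-|N(J)|$ and $b$ is defined on independent sets by $b(\varnothing)=1$ and $b(I)=\frac{1}{n-a(I)}\sum_{v\in I}b(I\setminus\{v\})$ for $I\ne\varnothing$.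
   Context: $N(J)$ denotes the set of vertices adjacent to at least one vertex of $J$. A set is independent if no two of its vertices are adjacent. -}

module Defs where

open import Data.Bool using (Bool; true; false; _∧_; _∨_; not; if_then_else_)
open import Data.Nat as ℕ using (ℕ; zero; suc)
open import Data.Fin as Fin using (Fin; toℕ)
open import Data.Fin.Subset using (Subset; _∈_; ∣_∣; _⊆_; Nonempty) renaming (_-_ to _∖_)
open import Data.Fin.Subset.Properties using (_∈?_; _⊆?_; nonempty?)
open import Data.Vec as Vec using (Vec; []; _∷_; lookup)
open import Data.List as List using (List; []; _∷_; allFin; filter; concatMap; length)
open import Data.Integer as ℤ using (ℤ; +_)
open import Data.Rational as ℚ using (ℚ; 0ℚ; 1ℚ; _+_; _-_; _*_; _÷_)
open import Data.Bool.ListAction using (any; all)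
open import Relation.Nullary using (¬_; yes; no; Dec)
open import Relation.Nullary.Decidable using (⌊_⌋)
open import Relation.Binary.PropositionalEquality using (_≡_)

record Graph (n : ℕ) : Set where
  field
    adj       : Fin n → Fin n → Bool
    symmetric : ∀ u v → adj u v ≡ adj v u
    irreflex  : ∀ v → adj v v ≡ false
open Graph public

data Reach {n : ℕ} (G : Graph n) : Fin n → Fin n → Set where
  here : ∀ {v} → Reach G v v
  step : ∀ {u w v} → adj G u w ≡ true → Reach G w v → Reach G u v

Connected : {n : ℕ} → Graph n → Set
Connected {n} G = (1 ℕ.≤ n) × (∀ u v → Reach G u v)
  where open import Data.Product using (_×_)

Independent : {n : ℕ} → Graph n → Subset n → Set
Independent G J = ∀ u v → u ∈ J → v ∈ J → adj G u v ≡ false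

memb : {n : ℕ} → Fin n → Subset n → Bool
memb v J = ⌊ v ∈? J ⌋

anyFin : {n : ℕ} → (Fin n → Bool) → Bool
anyFin {n} p = any p (allFin n)

allFin? : {n : ℕ} → (Fin n → Bool) → Bool
allFin? {n} p = all p (allFin n)

countFin : {n : ℕ} → (Fin n → Bool) → ℕ
countFin {n} p = length (filter (λ v → Data.Bool._≟_ (p v) true) (allFin n))
  where import Data.Bool

nbhdSize : {n : ℕ} → Graph n → Subset n → ℕ
nbhdSize G J = countFin (λ u → anyFin (λ v → memb v J ∧ adj G v u))

allSubsets : (n : ℕ) → List (Subset n)
allSubsets zero = [] ∷ []
allSubsets (suc n) = concatMap (λ s → (Bool.true ∷ s) ∷ (Bool.false ∷ s) ∷ []) (allSubsets n)
  where import Data.Bool as Bool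

-- Bijections V → {1,…,n}, encoded as injective maps Fin n → Fin n
-- (label k+1 is encoded by the Fin element k, so "π(v) = 1" is "π v = zero").

allVecs : {A : Set} → List A → (k : ℕ) → List (Vec A k)
allVecs xs zero = [] ∷ []
allVecs xs (suc k) = concatMap (λ x → List.map (x ∷_) (allVecs xs k)) xs

eqFin : {n : ℕ} → Fin n → Fin n → Bool
eqFin i j = ⌊ i Fin.≟ j ⌋

ltFin : {n : ℕ} → Fin n → Fin n → Bool
ltFin i j = ⌊ i Fin.<? j ⌋

injective? : {n : ℕ} → Vec (Fin n) n → Bool
injective? π = allFin? (λ i → allFin? (λ j → not (eqFin (lookup π i) (lookup π j)) ∨ eqFin i j))

Perms : (n : ℕ) → List (Vec (Fin n) n)
Perms n = filter (λ π → Data.Bool._≟_ (injective? π) true) (allVecs (allFin n) n)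
  where import Data.Bool

-- rational division, with the (never used here) convention x / 0 = 0

_÷'_ : ℚ → ℚ → ℚ
p ÷' q with q ℚ.≟ 0ℚ
... | yes _ = 0ℚ
... | no q≢0 = _÷_ p q {{ℚ.≢-nonZero q≢0}}
  where import Data.Rational.Properties

fromℕ : ℕ → ℚ
fromℕ k = (+ k) ℚ./ 1

Pr : {n : ℕ} → (Vec (Fin n) n → Bool) → ℚ
Pr {n} E = fromℕ (length (filter (λ π → Data.Bool._≟_ (E π) true) (Perms n)))
           ÷' fromℕ (length (Perms n))
  where import Data.Bool

B : {n : ℕ} → Graph n → Fin n → Vec (Fin n) n → Bool
B G v π = not ⌊ toℕ (lookup π v) ℕ.≟ 0 ⌋
          ∧ allFin? (λ u → not (adj G v u) ∨ ltFin (lookup π v) (lookup π u))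

Gd : {n : ℕ} → Graph n → Fin n → Vec (Fin n) n → Bool
Gd G v π = not (B G v π)

BJ : {n : ℕ} → Graph n → Subset n → Vec (Fin n) n → Bool
BJ G J π = allFin? (λ v → not (memb v J) ∨ B G v π)

GJ : {n : ℕ} → Graph n → Subset n → Vec (Fin n) n → Bool
GJ G J π = allFin? (λ v → not (memb v J) ∨ Gd G v π)

-- a(J) = n − |J| − |N(J)|  (computed in ℚ, no truncation)

a : {n : ℕ} → Graph n → Subset n → ℚ
a {n} G J = fromℕ n - fromℕ ∣ J ∣ - fromℕ (nbhdSize G J)

sumFin : {n : ℕ} → (Fin n → ℚ) → ℚ
sumFin {n} f = List.foldr (λ v acc → f v + acc) 0ℚ (allFin n)

-- b(∅) = 1,  b(I) = (1/(n − a(I))) Σ_{v∈I} b(I ∖ {v})  for I ≠ ∅.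
-- Defined by recursion on a fuel parameter; b I uses fuel |I|, which is
-- exact since |I ∖ {v}| = |I| − 1 for v ∈ I.
bAux : {n : ℕ} → Graph n → ℕ → Subset n → ℚ
bAux G zero I = 1ℚ
bAux {n} G (suc k) I with nonempty? I
... | no _  = 1ℚ
... | yes _ = sumFin (λ v → if memb v I then bAux G k (I ∖ v) else 0ℚ)
              ÷' (fromℕ n - a G I)

b : {n : ℕ} → Graph n → Subset n → ℚ
b G I = bAux G ∣ I ∣ I

signQ : ℕ → ℚ
signQ zero = 1ℚ
signQ (suc k) = ℚ.- signQ k

inclExcl : {n : ℕ} → Graph n → Subset n → ℚ
inclExcl {n} G J =
  List.foldr (λ T acc → (if ⌊ T ⊆? J ⌋ then signQ ∣ T ∣ * Pr (GJ G T) else 0ℚ) + acc)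
             0ℚ (allSubsets n)

{-# OPTIONS --safe #-}
-- Identify a bijection π with the arrangement σ = π⁻¹ listing the vertices by increasing label;
-- then B_v says that v is not first in σ and comes before all of its neighbours. Let F(A, J) count
-- the arrangements of a vertex set A ⊇ J ∪ N(J) in which every vertex of the independent set J comes
-- before its neighbours. Classify them by the first vertex x: for x ∈ J the rest is counted by
-- F(A ∖ x, J ∖ x), x ∈ N(J) is impossible, and each of the |A| − |J| − |N(J)| other choices leaves
-- F(A ∖ x, J). As the recursion defining b reads Σ_{x∈J} b(J ∖ x) = (|J| + |N(J)|) b(J), induction
-- gives F(A, J) = b(J) |A|!. For B_J the first vertex must avoid J ∪ N(J), so B_J has
-- a(J) b(J) (n−1)! elements and Pr(B_J) = a(J) b(J)/n. Since B_v is the complement of G_v, the second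
-- identity is inclusion–exclusion, which already holds pointwise for each π.
module Submission where

open import Defs
open import Data.Bool as Bool using (Bool; true; false; T; not; _∧_; _∨_; if_then_else_)
open import Data.Bool.Properties using (T-≡; T-not-≡; T-∧; T-∨; ∧-zeroʳ; ∧-identityʳ; not-involutive)
open import Data.Bool.ListAction using (and)
open import Data.Empty using (⊥-elim)
open import Data.Fin as Fin using (Fin; zero; suc; toℕ)
import Data.Fin.Properties as Finₚ
open import Data.Fin.Subset as Subset using (Subset; _∈_; _∉_; ∣_∣; ⊤; ⊥; ⁅_⁆) renaming (_-_ to _∖_)
open import Data.Fin.Subset.Properties
  using (_∈?_; _⊆?_; nonempty?; ∈⊤; ∣⊤∣≡n; ∣⊥∣≡0; p─⊥≡p; p─q⊆p; x∈p∧x≢y⇒x∈p-y; Empty-unique; p⊆q⇒∣p∣≤∣q∣)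
import Data.Integer as ℤ
import Data.Integer.Properties as ℤₚ
open import Data.List as List using (List; []; _∷_; _++_; map; concatMap; filter; length; foldr; allFin)
import Data.List.Properties as Listₚ
import Data.List.Relation.Unary.All.Properties as Allₚ
import Data.List.Relation.Unary.Any.Properties as Anyₚ
open import Data.Nat as ℕ using (ℕ; zero; suc; _!)
import Data.Nat.Properties as ℕₚ
open import Data.Nat.Coprimality using (1-coprimeTo) renaming (sym to coprime-sym)
open import Data.Product using (_×_; _,_; ∃; proj₁; proj₂)
open import Data.Sum using (inj₁; inj₂)
open import Data.Rational as ℚ using (ℚ; 0ℚ; 1ℚ; _+_; _*_; _-_; -_; mkℚ)
import Data.Rational.Properties as ℚₚ
open import Data.Rational.Solver using (module +-*-Solver)
open import Data.Vec as Vec using (Vec; []; _∷_; lookup; here; there)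
import Data.Vec.Properties as Vecₚ
open import Function using (_∘_; _∘₂_; id; _⇔_; mk⇔; Equivalence; Injective)
open import Relation.Binary.Definitions using (DecidableEquality)
open import Relation.Binary.PropositionalEquality
open import Relation.Nullary using (¬_; yes; no; contradiction)
open import Relation.Nullary.Decidable using (⌊_⌋; toWitness; fromWitness)

open +-*-Solver using (solve; _:+_; _:*_; _:-_; :-_; _:=_; con)

true≢false : true ≢ false
true≢false ()

≡true⇒T : ∀ {b} → b ≡ true → T b
≡true⇒T = Equivalence.from T-≡

T⇒≡true : ∀ {b} → T b → b ≡ true
T⇒≡true = Equivalence.to T-≡

¬T⇒≡false : ∀ {b} → ¬ T b → b ≡ false
¬T⇒≡false {false} _  = refl
¬T⇒≡false {true}  ¬t = ⊥-elim (¬t _)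

T-ext : ∀ {a b} → (T a → T b) → (T b → T a) → a ≡ b
T-ext {false} {false} _ _ = refl
T-ext {false} {true}  _ g = ⊥-elim (g _)
T-ext {true}  {false} f _ = ⊥-elim (f _)
T-ext {true}  {true}  _ _ = refl

T-implication : ∀ {a b} → T (not a ∨ b) ⇔ (T a → T b)
T-implication {false} = mk⇔ (λ _ ()) (λ _ → _)
T-implication {true}  = mk⇔ (λ t _ → t) (λ f → f _)

memb⇒∈ : ∀ {n} {v : Fin n} {J} → memb v J ≡ true → v ∈ J
memb⇒∈ = toWitness ∘ ≡true⇒T

∈⇒memb : ∀ {n} {v : Fin n} {J} → v ∈ J → memb v J ≡ true
∈⇒memb = T⇒≡true ∘ fromWitness

eqFin⇒≡ : ∀ {n} {i j : Fin n} → eqFin i j ≡ true → i ≡ j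
eqFin⇒≡ = toWitness ∘ ≡true⇒T

≡⇒eqFin : ∀ {n} {i j : Fin n} → i ≡ j → eqFin i j ≡ true
≡⇒eqFin = T⇒≡true ∘ fromWitness

≢⇒eqFin : ∀ {n} {i j : Fin n} → i ≢ j → eqFin i j ≡ false
≢⇒eqFin i≢j = ¬T⇒≡false (i≢j ∘ toWitness)

T-allFin? : ∀ {n} {p : Fin n → Bool} → T (allFin? p) ⇔ (∀ x → T (p x))
T-allFin? {n} {p} = mk⇔ (Allₚ.tabulate⁻ ∘ Allₚ.all⁺ p (allFin n)) (Allₚ.all⁻ p ∘ Allₚ.tabulate⁺)

T-anyFin : ∀ {n} {p : Fin n → Bool} → T (anyFin p) ⇔ ∃ λ x → T (p x)
T-anyFin {n} {p} = mk⇔ (Anyₚ.tabulate⁻ ∘ Anyₚ.any⁻ p (allFin n)) (λ (x , px) → Anyₚ.any⁺ p (Anyₚ.tabulate⁺ x px))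

allFin?-suc : ∀ {n} (p : Fin (suc n) → Bool) → allFin? p ≡ p zero ∧ allFin? (p ∘ suc)
allFin?-suc p = cong (λ bs → p zero ∧ and bs) (trans (Listₚ.map-tabulate suc p) (sym (Listₚ.map-tabulate id (p ∘ suc))))

allFin?-cong : ∀ {n} {p q : Fin n → Bool} → (∀ x → p x ≡ q x) → allFin? p ≡ allFin? q
allFin?-cong {n} p≗q = cong and (Listₚ.map-cong p≗q (allFin n))

memb-zero : ∀ {n} s (p : Subset n) → memb zero (s ∷ p) ≡ s
memb-zero true  p = refl
memb-zero false p = refl

memb-suc : ∀ {n} (v : Fin n) s p → memb (suc v) (s ∷ p) ≡ memb v p
memb-suc v s p with v ∈? p
... | yes _ = refl
... | no  _ = refl

eqFin-suc : ∀ {n} (i j : Fin n) → eqFin (suc i) (suc j) ≡ eqFin i j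
eqFin-suc i j with i Fin.≟ j
... | yes _ = refl
... | no  _ = refl

memb-∖ : ∀ {n} (A : Subset n) x v → memb v (A ∖ x) ≡ memb v A ∧ not (eqFin x v)
memb-∖ (s ∷ A) zero    zero    = sym (∧-zeroʳ (memb zero (s ∷ A)))
memb-∖ (s ∷ A) zero    (suc v) = begin
  memb (suc v) (false ∷ (A Subset.─ ⊥)) ≡⟨ memb-suc v false _ ⟩
  memb v (A Subset.─ ⊥)             ≡⟨ cong (memb v) (p─⊥≡p A) ⟩
  memb v A                          ≡⟨ sym (memb-suc v s A) ⟩
  memb (suc v) (s ∷ A)              ≡⟨ sym (∧-identityʳ _) ⟩
  memb (suc v) (s ∷ A) ∧ true       ∎
  where open ≡-Reasoning
memb-∖ (s ∷ A) (suc x) zero    = trans (memb-zero s (A ∖ x)) (sym (trans (∧-identityʳ _) (memb-zero s A)))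
memb-∖ (s ∷ A) (suc x) (suc v) = begin
  memb (suc v) (s ∷ (A ∖ x))                        ≡⟨ memb-suc v s (A ∖ x) ⟩
  memb v (A ∖ x)                                    ≡⟨ memb-∖ A x v ⟩
  memb v A ∧ not (eqFin x v)                        ≡⟨ sym (cong₂ (λ b c → b ∧ not c) (memb-suc v s A) (eqFin-suc x v)) ⟩
  memb (suc v) (s ∷ A) ∧ not (eqFin (suc x) (suc v)) ∎
  where open ≡-Reasoning

∈-∖⁻ : ∀ {n} {A : Subset n} {x v} → v ∈ A ∖ x → v ∈ A × x ≢ v
∈-∖⁻ {A = A} {x} {v} v∈A∖x with Equivalence.to (T-∧ {memb v A}) (subst T (memb-∖ A x v) (fromWitness v∈A∖x))
... | v∈A , x≉v = toWitness v∈A , λ x≡v → true≢false (trans (sym (≡⇒eqFin x≡v)) (Equivalence.to T-not-≡ x≉v))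

x∈p⇒suc∣p-x∣≡∣p∣ : ∀ {n} {x : Fin n} {p : Subset n} → x ∈ p → suc ∣ p ∖ x ∣ ≡ ∣ p ∣
x∈p⇒suc∣p-x∣≡∣p∣ {p = true ∷ p}  here        = cong (suc ∘ ∣_∣) (p─⊥≡p p)
x∈p⇒suc∣p-x∣≡∣p∣ {p = true ∷ p}  (there x∈p) = cong suc (x∈p⇒suc∣p-x∣≡∣p∣ x∈p)
x∈p⇒suc∣p-x∣≡∣p∣ {p = false ∷ p} (there x∈p) = x∈p⇒suc∣p-x∣≡∣p∣ x∈p

x∈p∧∣p∣≡1+k⇒∣p-x∣≡k : ∀ {n k} {x : Fin n} {p : Subset n} → x ∈ p → ∣ p ∣ ≡ suc k → ∣ p ∖ x ∣ ≡ k
x∈p∧∣p∣≡1+k⇒∣p-x∣≡k x∈p ∣p∣≡1+k = ℕₚ.suc-injective (trans (x∈p⇒suc∣p-x∣≡∣p∣ x∈p) ∣p∣≡1+k)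

∣p∣≡0⇒x∉p : ∀ {n} {p : Subset n} → ∣ p ∣ ≡ 0 → ∀ x → x ∉ p
∣p∣≡0⇒x∉p ∣p∣≡0 x x∈p = ℕₚ.0≢1+n (trans (sym ∣p∣≡0) (sym (x∈p⇒suc∣p-x∣≡∣p∣ x∈p)))

𝟙 : Bool → ℚ
𝟙 true  = 1ℚ
𝟙 false = 0ℚ

∑ : {A : Set} → (A → ℚ) → List A → ℚ
∑ f = foldr (λ x s → f x + s) 0ℚ

𝟙-∧ : ∀ a b → 𝟙 (a ∧ b) ≡ 𝟙 a * 𝟙 b
𝟙-∧ true  b = sym (ℚₚ.*-identityˡ (𝟙 b))
𝟙-∧ false b = sym (ℚₚ.*-zeroˡ (𝟙 b))

𝟙*-cong : ∀ c {y z} → (c ≡ true → y ≡ z) → 𝟙 c * y ≡ 𝟙 c * z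
𝟙*-cong true          y≡z = cong (1ℚ *_) (y≡z refl)
𝟙*-cong false {y} {z} _   = trans (ℚₚ.*-zeroˡ y) (sym (ℚₚ.*-zeroˡ z))

module _ {A : Set} where

  ∑-cong : ∀ {f g : A → ℚ} → (∀ x → f x ≡ g x) → ∀ xs → ∑ f xs ≡ ∑ g xs
  ∑-cong f≗g []       = refl
  ∑-cong f≗g (x ∷ xs) = cong₂ _+_ (f≗g x) (∑-cong f≗g xs)

  ∑-zero : ∀ {f : A → ℚ} → (∀ x → f x ≡ 0ℚ) → ∀ xs → ∑ f xs ≡ 0ℚ
  ∑-zero f≗0 []       = refl
  ∑-zero f≗0 (x ∷ xs) = cong₂ _+_ (f≗0 x) (∑-zero f≗0 xs)

  ∑-++ : ∀ (f : A → ℚ) xs ys → ∑ f (xs ++ ys) ≡ ∑ f xs + ∑ f ys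
  ∑-++ f []       ys = sym (ℚₚ.+-identityˡ _)
  ∑-++ f (x ∷ xs) ys = trans (cong (f x +_) (∑-++ f xs ys)) (sym (ℚₚ.+-assoc (f x) _ _))

  ∑-+ : ∀ (f g : A → ℚ) xs → ∑ (λ x → f x + g x) xs ≡ ∑ f xs + ∑ g xs
  ∑-+ f g []       = refl
  ∑-+ f g (x ∷ xs) = trans (cong (f x + g x +_) (∑-+ f g xs)) (interchange (f x) (g x) _ _)
    where
    interchange : ∀ a b c d → (a + b) + (c + d) ≡ (a + c) + (b + d)
    interchange = solve 4 (λ a b c d → (a :+ b) :+ (c :+ d) := (a :+ c) :+ (b :+ d)) refl

  ∑-*ˡ : ∀ c (f : A → ℚ) xs → ∑ (λ x → c * f x) xs ≡ c * ∑ f xs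
  ∑-*ˡ c f []       = sym (ℚₚ.*-zeroʳ c)
  ∑-*ˡ c f (x ∷ xs) = trans (cong (c * f x +_) (∑-*ˡ c f xs)) (sym (ℚₚ.*-distribˡ-+ c (f x) _))

  ∑-*ʳ : ∀ c (f : A → ℚ) xs → ∑ (λ x → f x * c) xs ≡ ∑ f xs * c
  ∑-*ʳ c f xs = trans (∑-cong (λ x → ℚₚ.*-comm (f x) c) xs) (trans (∑-*ˡ c f xs) (ℚₚ.*-comm c _))

  ∑-filter : ∀ (p : A → Bool) f xs →
             ∑ f (filter (λ x → p x Bool.≟ true) xs) ≡ ∑ (λ x → 𝟙 (p x) * f x) xs
  ∑-filter p f []       = refl
  ∑-filter p f (x ∷ xs) with p x
  ... | true  = cong₂ _+_ (sym (ℚₚ.*-identityˡ (f x))) (∑-filter p f xs)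
  ... | false = trans (∑-filter p f xs) (sym (trans (cong (_+ _) (ℚₚ.*-zeroˡ (f x))) (ℚₚ.+-identityˡ _)))

module _ {A B : Set} where

  ∑-map : ∀ (f : B → ℚ) (g : A → B) xs → ∑ f (map g xs) ≡ ∑ (f ∘ g) xs
  ∑-map f g = Listₚ.foldr-map _ g 0ℚ

  ∑-concatMap : ∀ (f : B → ℚ) (g : A → List B) xs → ∑ f (concatMap g xs) ≡ ∑ (∑ f ∘ g) xs
  ∑-concatMap f g []       = refl
  ∑-concatMap f g (x ∷ xs) = trans (∑-++ f (g x) (concatMap g xs)) (cong (∑ f (g x) +_) (∑-concatMap f g xs))

  ∑-swap : ∀ (f : A → B → ℚ) xs ys → ∑ (λ x → ∑ (f x) ys) xs ≡ ∑ (λ y → ∑ (λ x → f x y) xs) ys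
  ∑-swap f []       ys = sym (∑-zero (λ _ → refl) ys)
  ∑-swap f (x ∷ xs) ys = trans (cong (∑ (f x) ys +_) (∑-swap f xs ys)) (sym (∑-+ (f x) _ ys))

∑-allFin-suc : ∀ {n} (f : Fin (suc n) → ℚ) → ∑ f (allFin (suc n)) ≡ f zero + ∑ (f ∘ suc) (allFin n)
∑-allFin-suc {n} f = cong (f zero +_) (trans (cong (∑ f) (sym (Listₚ.map-tabulate id suc))) (∑-map f suc (allFin n)))

fromℕ-mkℚ : ∀ k → fromℕ k ≡ mkℚ (ℤ.+ k) 0 (coprime-sym (1-coprimeTo k))
fromℕ-mkℚ k = ℚₚ.normalize-coprime (coprime-sym (1-coprimeTo k))

fromℕ-+ : ∀ j k → fromℕ (j ℕ.+ k) ≡ fromℕ j + fromℕ k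
fromℕ-+ j k rewrite fromℕ-mkℚ j | fromℕ-mkℚ k = sym (ℚₚ./-cong
  (trans (cong₂ ℤ._+_ (ℤₚ.*-identityʳ (ℤ.+ j)) (ℤₚ.*-identityʳ (ℤ.+ k))) (sym (ℤₚ.pos-+ j k))) refl)

fromℕ-* : ∀ j k → fromℕ (j ℕ.* k) ≡ fromℕ j * fromℕ k
fromℕ-* j k rewrite fromℕ-mkℚ j | fromℕ-mkℚ k = sym (ℚₚ./-cong (sym (ℤₚ.pos-* j k)) refl)

fromℕ-≢0 : ∀ {k} → k ≢ 0 → fromℕ k ≢ 0ℚ
fromℕ-≢0 {k} k≢0 k≡0 = k≢0 (ℤₚ.+-injective (cong ℚ.↥_ (trans (sym (fromℕ-mkℚ k)) k≡0)))

fromℕ-length : ∀ {A : Set} (xs : List A) → fromℕ (length xs) ≡ ∑ (λ _ → 1ℚ) xs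
fromℕ-length []       = refl
fromℕ-length (x ∷ xs) = trans (fromℕ-+ 1 (length xs)) (cong (1ℚ +_) (fromℕ-length xs))

fromℕ-count : ∀ {A : Set} (p : A → Bool) xs →
              fromℕ (length (filter (λ x → p x Bool.≟ true) xs)) ≡ ∑ (𝟙 ∘ p) xs
fromℕ-count p xs = begin
  fromℕ (length (filter (λ x → p x Bool.≟ true) xs)) ≡⟨ fromℕ-length (filter (λ x → p x Bool.≟ true) xs) ⟩
  ∑ (λ _ → 1ℚ) (filter (λ x → p x Bool.≟ true) xs)   ≡⟨ ∑-filter p _ xs ⟩
  ∑ (λ x → 𝟙 (p x) * 1ℚ) xs                          ≡⟨ ∑-cong (ℚₚ.*-identityʳ ∘ 𝟙 ∘ p) xs ⟩
  ∑ (𝟙 ∘ p) xs                                        ∎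
  where open ≡-Reasoning

fromℕ-∣∣ : ∀ {n} (A : Subset n) → fromℕ ∣ A ∣ ≡ ∑ (λ v → 𝟙 (memb v A)) (allFin n)
fromℕ-∣∣ []      = refl
fromℕ-∣∣ {suc n} (s ∷ A) = begin
  fromℕ ∣ s ∷ A ∣                                                    ≡⟨ head-count s ⟩
  𝟙 s + fromℕ ∣ A ∣                                                  ≡⟨ cong₂ _+_ (cong 𝟙 (sym (memb-zero s A))) (fromℕ-∣∣ A) ⟩
  𝟙 (memb zero (s ∷ A)) + ∑ (λ v → 𝟙 (memb v A)) (allFin n)          ≡⟨ cong (𝟙 (memb zero (s ∷ A)) +_) (∑-cong (λ v → cong 𝟙 (sym (memb-suc v s A))) (allFin n)) ⟩
  𝟙 (memb zero (s ∷ A)) + ∑ (λ v → 𝟙 (memb (suc v) (s ∷ A))) (allFin n) ≡⟨ sym (∑-allFin-suc (λ v → 𝟙 (memb v (s ∷ A)))) ⟩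
  ∑ (λ v → 𝟙 (memb v (s ∷ A))) (allFin (suc n))                      ∎
  where
  open ≡-Reasoning
  head-count : ∀ s → fromℕ ∣ s ∷ A ∣ ≡ 𝟙 s + fromℕ ∣ A ∣
  head-count true  = fromℕ-+ 1 ∣ A ∣
  head-count false = sym (ℚₚ.+-identityˡ _)

1÷'-inverseʳ : ∀ {q} → q ≢ 0ℚ → q * (1ℚ ÷' q) ≡ 1ℚ
1÷'-inverseʳ {q} q≢0 with q ℚ.≟ 0ℚ
... | yes q≡0 = contradiction q≡0 q≢0
... | no  q≢0 = trans (cong (q *_) (ℚₚ.*-identityˡ _)) (ℚₚ.*-inverseʳ q {{ℚ.≢-nonZero q≢0}})

-- also for q = 0, where both sides are 0
÷'-≡-*1÷' : ∀ p q → p ÷' q ≡ p * (1ℚ ÷' q)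
÷'-≡-*1÷' p q with q ℚ.≟ 0ℚ
... | yes _ = sym (ℚₚ.*-zeroʳ p)
... | no  _ = cong (p *_) (sym (ℚₚ.*-identityˡ _))

*-÷'-assoc : ∀ p r q → p * (r ÷' q) ≡ (p * r) ÷' q
*-÷'-assoc p r q = begin
  p * (r ÷' q)         ≡⟨ cong (p *_) (÷'-≡-*1÷' r q) ⟩
  p * (r * (1ℚ ÷' q))  ≡⟨ sym (ℚₚ.*-assoc p r _) ⟩
  (p * r) * (1ℚ ÷' q)  ≡⟨ sym (÷'-≡-*1÷' (p * r) q) ⟩
  (p * r) ÷' q         ∎
  where open ≡-Reasoning

∑-÷' : ∀ {A : Set} (f : A → ℚ) q xs → ∑ (λ x → f x ÷' q) xs ≡ ∑ f xs ÷' q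
∑-÷' f q xs = begin
  ∑ (λ x → f x ÷' q) xs         ≡⟨ ∑-cong (λ x → ÷'-≡-*1÷' (f x) q) xs ⟩
  ∑ (λ x → f x * (1ℚ ÷' q)) xs  ≡⟨ ∑-*ʳ _ f xs ⟩
  ∑ f xs * (1ℚ ÷' q)            ≡⟨ sym (÷'-≡-*1÷' _ q) ⟩
  ∑ f xs ÷' q                   ∎
  where open ≡-Reasoning

÷'-unique : ∀ {p q r} → q ≢ 0ℚ → q * r ≡ p → p ÷' q ≡ r
÷'-unique {p} {q} {r} q≢0 q*r≡p = begin
  p ÷' q               ≡⟨ ÷'-≡-*1÷' p q ⟩
  p * (1ℚ ÷' q)        ≡⟨ cong (_* (1ℚ ÷' q)) (sym q*r≡p) ⟩
  (q * r) * (1ℚ ÷' q)  ≡⟨ rearrange q r _ ⟩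
  r * (q * (1ℚ ÷' q))  ≡⟨ cong (r *_) (1÷'-inverseʳ q≢0) ⟩
  r * 1ℚ               ≡⟨ ℚₚ.*-identityʳ r ⟩
  r                    ∎
  where
  open ≡-Reasoning
  rearrange : ∀ a b c → (a * b) * c ≡ b * (a * c)
  rearrange = solve 3 (λ a b c → (a :* b) :* c := b :* (a :* c)) refl

*-÷'-inverse : ∀ p {q} → q ≢ 0ℚ → q * (p ÷' q) ≡ p
*-÷'-inverse p {q} q≢0 = trans (*-÷'-assoc q p q) (÷'-unique q≢0 refl)

÷'-cancelʳ : ∀ p q c → q * c ≢ 0ℚ → (p * c) ÷' (q * c) ≡ p ÷' q
÷'-cancelʳ p q c qc≢0 = ÷'-unique qc≢0 (begin
  (q * c) * (p ÷' q)   ≡⟨ rearrange q c _ ⟩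
  (q * (p ÷' q)) * c   ≡⟨ cong (_* c) (*-÷'-inverse p q≢0) ⟩
  p * c                ∎)
  where
  open ≡-Reasoning
  q≢0 : q ≢ 0ℚ
  q≢0 q≡0 = qc≢0 (trans (cong (_* c) q≡0) (ℚₚ.*-zeroˡ c))
  rearrange : ∀ a b d → (a * b) * d ≡ (a * d) * b
  rearrange = solve 3 (λ a b d → (a :* b) :* d := (a :* d) :* b) refl

module _ {A : Set} (_≟_ : DecidableEquality A) where

  -- xs lists every element of A exactly once
  Sifting : List A → Set
  Sifting xs = ∀ y (g : A → ℚ) → ∑ (λ x → 𝟙 ⌊ x ≟ y ⌋ * g x) xs ≡ g y

  ∑-involution : ∀ {xs} → Sifting xs → (p : A → Bool) (h : A → A) →
                 (∀ x → T (p x) → T (p (h x))) → (∀ x → T (p x) → h (h x) ≡ x) →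
                 ∀ f → ∑ (λ x → 𝟙 (p x) * f (h x)) xs ≡ ∑ (λ x → 𝟙 (p x) * f x) xs
  ∑-involution {xs} sift p h p-closed h-involutive f = begin
    ∑ (λ τ → 𝟙 (p τ) * f (h τ)) xs
      ≡⟨ ∑-cong (λ τ → cong (𝟙 (p τ) *_) (sym (sift (h τ) f))) xs ⟩
    ∑ (λ τ → 𝟙 (p τ) * ∑ (λ σ → 𝟙 ⌊ σ ≟ h τ ⌋ * f σ) xs) xs
      ≡⟨ ∑-cong (λ τ → sym (∑-*ˡ (𝟙 (p τ)) (λ σ → 𝟙 ⌊ σ ≟ h τ ⌋ * f σ) xs)) xs ⟩
    ∑ (λ τ → ∑ (λ σ → 𝟙 (p τ) * (𝟙 ⌊ σ ≟ h τ ⌋ * f σ)) xs) xs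
      ≡⟨ ∑-swap (λ τ σ → 𝟙 (p τ) * (𝟙 ⌊ σ ≟ h τ ⌋ * f σ)) xs xs ⟩
    ∑ (λ σ → ∑ (λ τ → 𝟙 (p τ) * (𝟙 ⌊ σ ≟ h τ ⌋ * f σ)) xs) xs
      ≡⟨ ∑-cong (λ σ → ∑-cong (λ τ → swap-δ σ τ) xs) xs ⟩
    ∑ (λ σ → ∑ (λ τ → 𝟙 ⌊ τ ≟ h σ ⌋ * (𝟙 (p σ) * f σ)) xs) xs
      ≡⟨ ∑-cong (λ σ → sift (h σ) (λ _ → 𝟙 (p σ) * f σ)) xs ⟩
    ∑ (λ σ → 𝟙 (p σ) * f σ) xs ∎
    where
    open ≡-Reasoning
    T-δ : ∀ x y → T ⌊ x ≟ y ⌋ ⇔ x ≡ y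
    T-δ x y = mk⇔ toWitness fromWitness
    flip-δ : ∀ σ τ → T (p τ) → σ ≡ h τ → T (p σ) × τ ≡ h σ
    flip-δ _ τ pτ refl = p-closed τ pτ , sym (h-involutive τ pτ)
    δ-symmetric : ∀ σ τ → p τ ∧ ⌊ σ ≟ h τ ⌋ ≡ ⌊ τ ≟ h σ ⌋ ∧ p σ
    δ-symmetric σ τ = T-ext
      (λ t → let pτ , σ≡hτ = Equivalence.to (T-∧ {p τ}) t
                 pσ , τ≡hσ = flip-δ σ τ pτ (Equivalence.to (T-δ σ (h τ)) σ≡hτ)
             in Equivalence.from T-∧ (Equivalence.from (T-δ τ (h σ)) τ≡hσ , pσ))
      (λ t → let τ≡hσ , pσ = Equivalence.to (T-∧ {⌊ τ ≟ h σ ⌋}) t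
                 pτ , σ≡hτ = flip-δ τ σ pσ (Equivalence.to (T-δ τ (h σ)) τ≡hσ)
             in Equivalence.from T-∧ (pτ , Equivalence.from (T-δ σ (h τ)) σ≡hτ))
    swap-δ : ∀ σ τ → 𝟙 (p τ) * (𝟙 ⌊ σ ≟ h τ ⌋ * f σ) ≡ 𝟙 ⌊ τ ≟ h σ ⌋ * (𝟙 (p σ) * f σ)
    swap-δ σ τ = begin
      𝟙 (p τ) * (𝟙 ⌊ σ ≟ h τ ⌋ * f σ)   ≡⟨ sym (ℚₚ.*-assoc (𝟙 (p τ)) _ (f σ)) ⟩
      𝟙 (p τ) * 𝟙 ⌊ σ ≟ h τ ⌋ * f σ     ≡⟨ cong (_* f σ) (sym (𝟙-∧ (p τ) ⌊ σ ≟ h τ ⌋)) ⟩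
      𝟙 (p τ ∧ ⌊ σ ≟ h τ ⌋) * f σ       ≡⟨ cong (λ b → 𝟙 b * f σ) (δ-symmetric σ τ) ⟩
      𝟙 (⌊ τ ≟ h σ ⌋ ∧ p σ) * f σ       ≡⟨ cong (_* f σ) (𝟙-∧ ⌊ τ ≟ h σ ⌋ (p σ)) ⟩
      𝟙 ⌊ τ ≟ h σ ⌋ * 𝟙 (p σ) * f σ     ≡⟨ ℚₚ.*-assoc (𝟙 ⌊ τ ≟ h σ ⌋) _ (f σ) ⟩
      𝟙 ⌊ τ ≟ h σ ⌋ * (𝟙 (p σ) * f σ)   ∎

allFin-sifting : ∀ {n} → Sifting Fin._≟_ (allFin n)
allFin-sifting {suc n} zero    g = begin
  ∑ (λ x → 𝟙 ⌊ x Fin.≟ zero ⌋ * g x) (allFin (suc n))  ≡⟨ ∑-allFin-suc (λ x → 𝟙 ⌊ x Fin.≟ zero ⌋ * g x) ⟩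
  1ℚ * g zero + ∑ (λ x → 0ℚ * g (suc x)) (allFin n)     ≡⟨ cong₂ _+_ (ℚₚ.*-identityˡ (g zero)) (∑-zero (ℚₚ.*-zeroˡ ∘ g ∘ suc) (allFin n)) ⟩
  g zero + 0ℚ                                           ≡⟨ ℚₚ.+-identityʳ (g zero) ⟩
  g zero                                                ∎
  where open ≡-Reasoning
allFin-sifting {suc n} (suc y) g = begin
  ∑ (λ x → 𝟙 ⌊ x Fin.≟ suc y ⌋ * g x) (allFin (suc n))                  ≡⟨ ∑-allFin-suc (λ x → 𝟙 ⌊ x Fin.≟ suc y ⌋ * g x) ⟩
  0ℚ * g zero + ∑ (λ x → 𝟙 (eqFin (suc x) (suc y)) * g (suc x)) (allFin n) ≡⟨ cong₂ _+_ (ℚₚ.*-zeroˡ (g zero)) (∑-cong (λ x → cong (λ b → 𝟙 b * g (suc x)) (eqFin-suc x y)) (allFin n)) ⟩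
  0ℚ + ∑ (λ x → 𝟙 ⌊ x Fin.≟ y ⌋ * g (suc x)) (allFin n)                  ≡⟨ ℚₚ.+-identityˡ (∑ (λ x → 𝟙 ⌊ x Fin.≟ y ⌋ * g (suc x)) (allFin n)) ⟩
  ∑ (λ x → 𝟙 ⌊ x Fin.≟ y ⌋ * g (suc x)) (allFin n)                       ≡⟨ allFin-sifting y (g ∘ suc) ⟩
  g (suc y)                                                              ∎
  where open ≡-Reasoning

module _ {A : Set} {_≟_ : DecidableEquality A} where

  private
    _≟ᵥ_ : ∀ {k} → DecidableEquality (Vec A k)
    _≟ᵥ_ = Vecₚ.≡-dec _≟_

  δ-∷ : ∀ {k} (x y : A) (σ τ : Vec A k) → ⌊ (x ∷ σ) ≟ᵥ (y ∷ τ) ⌋ ≡ ⌊ x ≟ y ⌋ ∧ ⌊ σ ≟ᵥ τ ⌋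
  δ-∷ x y σ τ with x ≟ y | σ ≟ᵥ τ
  ... | yes _ | yes _ = refl
  ... | yes _ | no  _ = refl
  ... | no  _ | _     = refl

  allVecs-sifting : ∀ {xs} → Sifting _≟_ xs → ∀ k → Sifting _≟ᵥ_ (allVecs xs k)
  allVecs-sifting sift zero    [] g = trans (cong (_+ 0ℚ) (ℚₚ.*-identityˡ (g []))) (ℚₚ.+-identityʳ (g []))
  allVecs-sifting {xs} sift (suc k) (y ∷ τ) g = begin
    ∑ (λ σ → 𝟙 ⌊ σ ≟ᵥ (y ∷ τ) ⌋ * g σ) (concatMap (λ x → map (x ∷_) (allVecs xs k)) xs)
      ≡⟨ ∑-concatMap (λ σ → 𝟙 ⌊ σ ≟ᵥ (y ∷ τ) ⌋ * g σ) (λ x → map (x ∷_) (allVecs xs k)) xs ⟩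
    ∑ (λ x → ∑ (λ σ → 𝟙 ⌊ σ ≟ᵥ (y ∷ τ) ⌋ * g σ) (map (x ∷_) (allVecs xs k))) xs
      ≡⟨ ∑-cong (λ x → trans (∑-map (λ σ → 𝟙 ⌊ σ ≟ᵥ (y ∷ τ) ⌋ * g σ) (x ∷_) (allVecs xs k)) (∑-cong (split x) (allVecs xs k))) xs ⟩
    ∑ (λ x → ∑ (λ σ → 𝟙 ⌊ x ≟ y ⌋ * (𝟙 ⌊ σ ≟ᵥ τ ⌋ * g (x ∷ σ))) (allVecs xs k)) xs
      ≡⟨ ∑-cong (λ x → ∑-*ˡ (𝟙 ⌊ x ≟ y ⌋) (λ σ → 𝟙 ⌊ σ ≟ᵥ τ ⌋ * g (x ∷ σ)) (allVecs xs k)) xs ⟩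
    ∑ (λ x → 𝟙 ⌊ x ≟ y ⌋ * ∑ (λ σ → 𝟙 ⌊ σ ≟ᵥ τ ⌋ * g (x ∷ σ)) (allVecs xs k)) xs
      ≡⟨ ∑-cong (λ x → cong (𝟙 ⌊ x ≟ y ⌋ *_) (allVecs-sifting sift k τ (g ∘ (x ∷_)))) xs ⟩
    ∑ (λ x → 𝟙 ⌊ x ≟ y ⌋ * g (x ∷ τ)) xs
      ≡⟨ sift y (λ x → g (x ∷ τ)) ⟩
    g (y ∷ τ) ∎
    where
    open ≡-Reasoning
    split : ∀ x σ → 𝟙 ⌊ (x ∷ σ) ≟ᵥ (y ∷ τ) ⌋ * g (x ∷ σ) ≡ 𝟙 ⌊ x ≟ y ⌋ * (𝟙 ⌊ σ ≟ᵥ τ ⌋ * g (x ∷ σ))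
    split x σ = trans (cong (_* g (x ∷ σ)) (trans (cong 𝟙 (δ-∷ x y σ τ)) (𝟙-∧ ⌊ x ≟ y ⌋ ⌊ σ ≟ᵥ τ ⌋)))
                      (ℚₚ.*-assoc (𝟙 ⌊ x ≟ y ⌋) (𝟙 ⌊ σ ≟ᵥ τ ⌋) (g (x ∷ σ)))

injective⇒surjective : ∀ {n} {f : Fin n → Fin n} → Injective _≡_ _≡_ f → ∀ y → ∃ λ x → f x ≡ y
injective⇒surjective {suc m} {f} f-inj y with Finₚ.any? (λ x → f x Fin.≟ y)
... | yes hit  = hit
... | no  miss = contradiction (Finₚ.injective⇒≤ f′-inj) ℕₚ.1+n≰n
  where
  f≢y : ∀ x → y ≢ f x
  f≢y x y≡fx = miss (x , sym y≡fx)
  f′ : Fin (suc m) → Fin m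
  f′ x = Fin.punchOut (f≢y x)
  f′-inj : Injective _≡_ _≡_ f′
  f′-inj {x} {x′} = f-inj ∘ Finₚ.punchOut-injective (f≢y x) (f≢y x′)

-- the junk value v is only returned when v has no preimage under σ
preimage : ∀ {n} → Vec (Fin n) n → Fin n → Fin n
preimage σ v with Finₚ.any? (λ i → lookup σ i Fin.≟ v)
... | yes (i , _) = i
... | no  _       = v

inverse : ∀ {n} → Vec (Fin n) n → Vec (Fin n) n
inverse σ = Vec.tabulate (preimage σ)

module _ {n} {σ : Vec (Fin n) n} (σ-inj : Injective _≡_ _≡_ (lookup σ)) where

  lookup-preimage : ∀ v → lookup σ (preimage σ v) ≡ v
  lookup-preimage v with Finₚ.any? (λ i → lookup σ i Fin.≟ v)
  ... | yes (_ , σi≡v) = σi≡v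
  ... | no  miss       = contradiction (injective⇒surjective σ-inj v) miss

  lookup-inverse : ∀ v → lookup σ (lookup (inverse σ) v) ≡ v
  lookup-inverse v = trans (cong (lookup σ) (Vecₚ.lookup∘tabulate (preimage σ) v)) (lookup-preimage v)

  inverse-lookup : ∀ i → lookup (inverse σ) (lookup σ i) ≡ i
  inverse-lookup i = σ-inj (lookup-inverse (lookup σ i))

  inverse-injective : Injective _≡_ _≡_ (lookup (inverse σ))
  inverse-injective {v} {w} σ⁻¹v≡σ⁻¹w =
    trans (sym (lookup-inverse v)) (trans (cong (lookup σ) σ⁻¹v≡σ⁻¹w) (lookup-inverse w))

inverse-involutive : ∀ {n} {σ : Vec (Fin n) n} → Injective _≡_ _≡_ (lookup σ) → inverse (inverse σ) ≡ σ
inverse-involutive {σ = σ} σ-inj = trans (Vecₚ.tabulate-cong preimage≗σ) (Vecₚ.tabulate∘lookup σ)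
  where
  preimage≗σ : ∀ i → preimage (inverse σ) i ≡ lookup σ i
  preimage≗σ i = inverse-injective {σ = σ} σ-inj
    (trans (lookup-preimage {σ = inverse σ} (inverse-injective {σ = σ} σ-inj) i) (sym (inverse-lookup {σ = σ} σ-inj i)))

T-injective? : ∀ {n} (π : Vec (Fin n) n) → T (injective? π) ⇔ Injective _≡_ _≡_ (lookup π)
T-injective? π = mk⇔
  (λ t {i} {j} πi≡πj → toWitness (Equivalence.to (T-implication {eqFin (lookup π i) (lookup π j)})
     (Equivalence.to T-allFin? (Equivalence.to T-allFin? t i) j) (fromWitness πi≡πj)))
  (λ π-inj → Equivalence.from T-allFin? λ i → Equivalence.from T-allFin? λ j →
     Equivalence.from (T-implication {eqFin (lookup π i) (lookup π j)}) (fromWitness ∘ π-inj ∘ toWitness))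

-- Arrangements: vectors of distinct elements of a subset

distinctIn : ∀ {n k} → Subset n → Vec (Fin n) k → Bool
distinctIn A []      = true
distinctIn A (x ∷ σ) = memb x A ∧ distinctIn (A ∖ x) σ

T-distinctIn : ∀ {n k} {A : Subset n} (σ : Vec (Fin n) k) →
               T (distinctIn A σ) ⇔ ((∀ i → lookup σ i ∈ A) × Injective _≡_ _≡_ (lookup σ))
T-distinctIn []      = mk⇔ (λ _ → (λ ()) , λ {i} → ⊥-elim (Finₚ.¬Fin0 i)) (λ _ → _)
T-distinctIn {A = A} (x ∷ σ) = mk⇔ to from
  where
  to : T (distinctIn A (x ∷ σ)) → (∀ i → lookup (x ∷ σ) i ∈ A) × Injective _≡_ _≡_ (lookup (x ∷ σ))
  to t with Equivalence.to (T-∧ {memb x A}) t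
  ... | x∈A , σ-distinct with Equivalence.to (T-distinctIn σ) σ-distinct
  ... | σ⊆A∖x , σ-inj = all∈ , inj
    where
    all∈ : ∀ i → lookup (x ∷ σ) i ∈ A
    all∈ zero    = toWitness x∈A
    all∈ (suc i) = proj₁ (∈-∖⁻ (σ⊆A∖x i))
    inj : Injective _≡_ _≡_ (lookup (x ∷ σ))
    inj {zero}  {zero}  _     = refl
    inj {zero}  {suc j} x≡σj  = contradiction x≡σj (proj₂ (∈-∖⁻ (σ⊆A∖x j)))
    inj {suc i} {zero}  σi≡x  = contradiction (sym σi≡x) (proj₂ (∈-∖⁻ (σ⊆A∖x i)))
    inj {suc i} {suc j} σi≡σj = cong suc (σ-inj σi≡σj)
  from : (∀ i → lookup (x ∷ σ) i ∈ A) × Injective _≡_ _≡_ (lookup (x ∷ σ)) → T (distinctIn A (x ∷ σ))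
  from (all∈ , inj) = Equivalence.from T-∧ (fromWitness (all∈ zero) , Equivalence.from (T-distinctIn σ)
    ( (λ i → x∈p∧x≢y⇒x∈p-y (all∈ (suc i)) (λ σi≡x → Finₚ.0≢1+n (sym (inj σi≡x))))
    , Finₚ.suc-injective ∘ inj))

injective?≡distinctIn-⊤ : ∀ {n} (σ : Vec (Fin n) n) → injective? σ ≡ distinctIn ⊤ σ
injective?≡distinctIn-⊤ σ = T-ext
  (λ t → Equivalence.from (T-distinctIn σ) ((λ _ → ∈⊤) , Equivalence.to (T-injective? σ) t))
  (λ t → Equivalence.from (T-injective? σ) (proj₂ (Equivalence.to (T-distinctIn σ) t)))

∑-Perms : ∀ {n} (f : Vec (Fin n) n → ℚ) →
          ∑ f (Perms n) ≡ ∑ (λ σ → 𝟙 (distinctIn ⊤ σ) * f (inverse σ)) (allVecs (allFin n) n)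
∑-Perms {n} f = begin
  ∑ f (Perms n)                                      ≡⟨ ∑-filter injective? f vecs ⟩
  ∑ (λ σ → 𝟙 (injective? σ) * f σ) vecs              ≡⟨ sym (∑-involution (Vecₚ.≡-dec Fin._≟_) {vecs} (allVecs-sifting {_≟_ = Fin._≟_} {allFin n} allFin-sifting n)
                                                            injective? inverse inverse-closed inverse-involutive′ f) ⟩
  ∑ (λ σ → 𝟙 (injective? σ) * f (inverse σ)) vecs    ≡⟨ ∑-cong (λ σ → cong (λ b → 𝟙 b * f (inverse σ)) (injective?≡distinctIn-⊤ σ)) vecs ⟩
  ∑ (λ σ → 𝟙 (distinctIn ⊤ σ) * f (inverse σ)) vecs  ∎
  where
  open ≡-Reasoning
  vecs : List (Vec (Fin n) n)
  vecs = allVecs (allFin n) n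
  inverse-closed : ∀ σ → T (injective? σ) → T (injective? (inverse σ))
  inverse-closed σ = Equivalence.from (T-injective? (inverse σ)) ∘ inverse-injective ∘ Equivalence.to (T-injective? σ)
  inverse-involutive′ : ∀ σ → T (injective? σ) → inverse (inverse σ) ≡ σ
  inverse-involutive′ σ = inverse-involutive ∘ Equivalence.to (T-injective? σ)

#arrangements : ∀ {n} k → Subset n → (Vec (Fin n) k → Bool) → ℚ
#arrangements {n} k A P = ∑ (λ σ → 𝟙 (distinctIn A σ) * 𝟙 (P σ)) (allVecs (allFin n) k)

module _ {n k : ℕ} (A : Subset n) where

  #arrangements-cong : ∀ (P Q : Vec (Fin n) k → Bool) → (∀ σ → T (distinctIn A σ) → P σ ≡ Q σ) →
                       #arrangements k A P ≡ #arrangements k A Q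
  #arrangements-cong P Q P≡Q = ∑-cong (λ σ → 𝟙*-cong (distinctIn A σ) (cong 𝟙 ∘ P≡Q σ ∘ ≡true⇒T)) (allVecs (allFin n) k)

  #arrangements-none : ∀ (P : Vec (Fin n) k → Bool) → (∀ σ → P σ ≡ false) → #arrangements k A P ≡ 0ℚ
  #arrangements-none P P≡false =
    ∑-zero (λ σ → trans (cong (λ b → 𝟙 (distinctIn A σ) * 𝟙 b) (P≡false σ)) (ℚₚ.*-zeroʳ (𝟙 (distinctIn A σ))))
           (allVecs (allFin n) k)

  #arrangements-∧ : ∀ c (P : Vec (Fin n) k → Bool) → #arrangements k A (λ σ → c ∧ P σ) ≡ 𝟙 c * #arrangements k A P
  #arrangements-∧ c P = trans (∑-cong pointwise (allVecs (allFin n) k))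
                              (∑-*ˡ (𝟙 c) (λ σ → 𝟙 (distinctIn A σ) * 𝟙 (P σ)) (allVecs (allFin n) k))
    where
    pointwise : ∀ σ → 𝟙 (distinctIn A σ) * 𝟙 (c ∧ P σ) ≡ 𝟙 c * (𝟙 (distinctIn A σ) * 𝟙 (P σ))
    pointwise σ = trans (cong (𝟙 (distinctIn A σ) *_) (𝟙-∧ c (P σ))) (rearrange (𝟙 (distinctIn A σ)) (𝟙 c) (𝟙 (P σ)))
      where
      rearrange : ∀ a b d → a * (b * d) ≡ b * (a * d)
      rearrange = solve 3 (λ a b d → a :* (b :* d) := b :* (a :* d)) refl

#arrangements-∷ : ∀ {n k} (A : Subset n) (P : Vec (Fin n) (suc k) → Bool) →
                  #arrangements (suc k) A P ≡ ∑ (λ x → 𝟙 (memb x A) * #arrangements k (A ∖ x) (P ∘ (x ∷_))) (allFin n)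
#arrangements-∷ {n} {k} A P = begin
  #arrangements (suc k) A P
    ≡⟨ ∑-concatMap term (λ x → map (x ∷_) (allVecs (allFin n) k)) (allFin n) ⟩
  ∑ (λ x → ∑ term (map (x ∷_) (allVecs (allFin n) k))) (allFin n)
    ≡⟨ ∑-cong (λ x → trans (∑-map term (x ∷_) (allVecs (allFin n) k))
                     (trans (∑-cong (split x) (allVecs (allFin n) k))
                            (∑-*ˡ (𝟙 (memb x A)) (λ σ → 𝟙 (distinctIn (A ∖ x) σ) * 𝟙 (P (x ∷ σ))) (allVecs (allFin n) k))))
              (allFin n) ⟩
  ∑ (λ x → 𝟙 (memb x A) * #arrangements k (A ∖ x) (P ∘ (x ∷_))) (allFin n) ∎
  where
  open ≡-Reasoning
  term : Vec (Fin n) (suc k) → ℚ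
  term σ = 𝟙 (distinctIn A σ) * 𝟙 (P σ)
  split : ∀ x σ → term (x ∷ σ) ≡ 𝟙 (memb x A) * (𝟙 (distinctIn (A ∖ x) σ) * 𝟙 (P (x ∷ σ)))
  split x σ = trans (cong (_* 𝟙 (P (x ∷ σ))) (𝟙-∧ (memb x A) (distinctIn (A ∖ x) σ)))
                    (ℚₚ.*-assoc (𝟙 (memb x A)) (𝟙 (distinctIn (A ∖ x) σ)) (𝟙 (P (x ∷ σ))))

#arrangements-all : ∀ {n} k {A : Subset n} → ∣ A ∣ ≡ k → #arrangements k A (λ _ → true) ≡ fromℕ (k !)
#arrangements-all zero    _ = refl
#arrangements-all {n} (suc k) {A} ∣A∣≡1+k = begin
  #arrangements (suc k) A (λ _ → true)
    ≡⟨ #arrangements-∷ A (λ _ → true) ⟩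
  ∑ (λ x → 𝟙 (memb x A) * #arrangements k (A ∖ x) (λ _ → true)) (allFin n)
    ≡⟨ ∑-cong (λ x → 𝟙*-cong (memb x A) (λ x∈A → #arrangements-all k (x∈p∧∣p∣≡1+k⇒∣p-x∣≡k (memb⇒∈ x∈A) ∣A∣≡1+k))) (allFin n) ⟩
  ∑ (λ x → 𝟙 (memb x A) * fromℕ (k !)) (allFin n)
    ≡⟨ ∑-*ʳ (fromℕ (k !)) (λ x → 𝟙 (memb x A)) (allFin n) ⟩
  ∑ (λ x → 𝟙 (memb x A)) (allFin n) * fromℕ (k !)
    ≡⟨ cong (_* fromℕ (k !)) (trans (sym (fromℕ-∣∣ A)) (cong fromℕ ∣A∣≡1+k)) ⟩
  fromℕ (suc k) * fromℕ (k !)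
    ≡⟨ sym (fromℕ-* (suc k) (k !)) ⟩
  fromℕ (suc k !) ∎
  where open ≡-Reasoning

every : ∀ {n} → Subset n → (Fin n → Bool) → Bool
every J g = allFin? (λ v → not (memb v J) ∨ g v)

T-every : ∀ {n} {J : Subset n} {g} → T (every J g) ⇔ (∀ v → v ∈ J → T (g v))
T-every {J = J} {g} = mk⇔
  (λ t v v∈J → Equivalence.to (T-implication {memb v J}) (Equivalence.to T-allFin? t v) (fromWitness v∈J))
  (λ h → Equivalence.from T-allFin? λ v → Equivalence.from (T-implication {memb v J}) (h v ∘ toWitness))

every-∷ : ∀ {n} t (s : Subset n) g → every (t ∷ s) g ≡ (not t ∨ g zero) ∧ every s (g ∘ suc)
every-∷ t s g = trans (allFin?-suc (λ v → not (memb v (t ∷ s)) ∨ g v)) (cong₂ _∧_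
  (cong (λ b → not b ∨ g zero) (memb-zero t s))
  (allFin?-cong (λ v → cong (λ b → not b ∨ g (suc v)) (memb-suc v t s))))

every-≢-∧ : ∀ {n} (J : Subset n) x g → every J (λ v → not (eqFin x v) ∧ g v) ≡ not (memb x J) ∧ every J g
every-≢-∧ J x g = T-ext to from
  where
  T-every-x≢∧g : T (every J (λ v → not (eqFin x v) ∧ g v)) ⇔ (∀ v → v ∈ J → T (not (eqFin x v) ∧ g v))
  T-every-x≢∧g = T-every
  T-every-g : T (every J g) ⇔ (∀ v → v ∈ J → T (g v))
  T-every-g = T-every
  to : T (every J (λ v → not (eqFin x v) ∧ g v)) → T (not (memb x J) ∧ every J g)
  to t = Equivalence.from T-∧ (Equivalence.from T-not-≡ (¬T⇒≡false x∉J) , Equivalence.from T-every-g (proj₂ ∘₂ x≢∧g))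
    where
    x≢∧g : ∀ v → v ∈ J → T (not (eqFin x v)) × T (g v)
    x≢∧g v v∈J = Equivalence.to (T-∧ {not (eqFin x v)}) (Equivalence.to T-every-x≢∧g t v v∈J)
    x∉J : ¬ T (memb x J)
    x∉J x∈J = true≢false (trans (sym (≡⇒eqFin refl)) (Equivalence.to T-not-≡ (proj₁ (x≢∧g x (toWitness x∈J)))))
  from : T (not (memb x J) ∧ every J g) → T (every J (λ v → not (eqFin x v) ∧ g v))
  from t with Equivalence.to (T-∧ {not (memb x J)}) t
  ... | x∉J , all-g = Equivalence.from T-every-x≢∧g λ v v∈J → Equivalence.from T-∧
    ( Equivalence.from T-not-≡ (≢⇒eqFin λ { refl → true≢false (trans (sym (∈⇒memb v∈J)) (Equivalence.to T-not-≡ x∉J)) })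
    , Equivalence.to T-every-g all-g v v∈J)

module _ {n} (G : Graph n) where

  nbhd : Subset n → Fin n → Bool
  nbhd J u = anyFin (λ v → memb v J ∧ adj G v u)

  infix 4 N[_]⊆_
  N[_]⊆_ : Subset n → Subset n → Set
  N[ J ]⊆ A = ∀ u → T (memb u J ∨ nbhd J u) → u ∈ A

  module _ {J : Subset n} {u : Fin n} where

    nbhd⁺ : ∀ {v} → v ∈ J → adj G v u ≡ true → nbhd J u ≡ true
    nbhd⁺ {v} v∈J vu = T⇒≡true (Equivalence.from T-anyFin (v , Equivalence.from T-∧ (fromWitness v∈J , ≡true⇒T vu)))

    nbhd⁻ : nbhd J u ≡ true → ∃ λ v → v ∈ J × adj G v u ≡ true
    nbhd⁻ u∈NJ with Equivalence.to T-anyFin (≡true⇒T u∈NJ)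
    ... | v , t with Equivalence.to (T-∧ {memb v J}) t
    ... | v∈J , vu = v , toWitness v∈J , T⇒≡true vu

    Independent⇒∉nbhd : Independent G J → u ∈ J → nbhd J u ≡ false
    Independent⇒∉nbhd ind u∈J = ¬T⇒≡false λ t →
      let v , v∈J , vu = nbhd⁻ (T⇒≡true t) in true≢false (trans (sym vu) (ind v u v∈J u∈J))

  Independent-∖ : ∀ {J} x → Independent G J → Independent G (J ∖ x)
  Independent-∖ {J} x ind u v u∈J∖x v∈J∖x = ind u v (p─q⊆p J ⁅ x ⁆ u∈J∖x) (p─q⊆p J ⁅ x ⁆ v∈J∖x)

  N[]⊆-∖-∈ : ∀ {J A x} → Independent G J → x ∈ J → N[ J ]⊆ A → N[ J ∖ x ]⊆ A ∖ x
  N[]⊆-∖-∈ {J} {A} {x} ind x∈J N[J]⊆A u t with Equivalence.to (T-∨ {memb u (J ∖ x)}) t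
  ... | inj₁ u∈J∖x =
    let u∈J , x≢u = ∈-∖⁻ (toWitness u∈J∖x)
    in x∈p∧x≢y⇒x∈p-y (N[J]⊆A u (Equivalence.from (T-∨ {memb u J}) (inj₁ (fromWitness u∈J)))) (x≢u ∘ sym)
  ... | inj₂ u∈N[J∖x] =
    let v , v∈J∖x , vu = nbhd⁻ (T⇒≡true u∈N[J∖x])
        v∈J = proj₁ (∈-∖⁻ v∈J∖x)
    in x∈p∧x≢y⇒x∈p-y (N[J]⊆A u (Equivalence.from (T-∨ {memb u J}) (inj₂ (≡true⇒T (nbhd⁺ v∈J vu)))))
                     (λ { refl → true≢false (trans (sym vu) (ind v u v∈J x∈J)) })

  N[]⊆-∖-∉ : ∀ {J A x} → memb x J ∨ nbhd J x ≡ false → N[ J ]⊆ A → N[ J ]⊆ A ∖ x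
  N[]⊆-∖-∉ {x = x} x∉N[J] N[J]⊆A u t =
    x∈p∧x≢y⇒x∈p-y (N[J]⊆A u t) (λ { refl → true≢false (trans (sym (T⇒≡true t)) x∉N[J]) })

  -- v occurs in σ before each of its neighbours (if v does not occur, no neighbour may occur)
  localMin : ∀ {k} → Fin n → Vec (Fin n) k → Bool
  localMin v []      = true
  localMin v (x ∷ σ) = eqFin x v ∨ (not (adj G v x) ∧ localMin v σ)

  localMins : ∀ {k} → Subset n → Vec (Fin n) k → Bool
  localMins J σ = every J (λ v → localMin v σ)

  LocalMin : ∀ {k} → Fin n → Vec (Fin n) k → Set
  LocalMin v σ = ∀ i → adj G v (lookup σ i) ≡ true → ∃ λ j → j Fin.< i × lookup σ j ≡ v

  localMin⁻ : ∀ {k} v (σ : Vec (Fin n) k) → T (localMin v σ) → LocalMin v σ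
  localMin⁻ v (x ∷ σ) t i vσi with eqFin x v in x≟v | i
  ... | true  | zero  = contradiction (trans (sym vσi) (trans (cong (adj G v) (eqFin⇒≡ x≟v)) (irreflex G v))) true≢false
  ... | true  | suc _ = zero , ℕ.s≤s ℕ.z≤n , eqFin⇒≡ x≟v
  ... | false | zero  = contradiction (trans (sym vσi) (Equivalence.to T-not-≡ (proj₁ (Equivalence.to (T-∧ {not (adj G v x)}) t)))) true≢false
  ... | false | suc i with localMin⁻ v σ (proj₂ (Equivalence.to (T-∧ {not (adj G v x)}) t)) i vσi
  ...   | j , j<i , σj≡v = suc j , ℕ.s≤s j<i , σj≡v

  localMin⁺ : ∀ {k} v (σ : Vec (Fin n) k) → LocalMin v σ → T (localMin v σ)
  localMin⁺ v []      _        = _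
  localMin⁺ v (x ∷ σ) earlier with eqFin x v in x≟v
  ... | true  = _
  ... | false = Equivalence.from T-∧ (Equivalence.from T-not-≡ (¬T⇒≡false x-not-adjacent) , localMin⁺ v σ earlier′)
    where
    x-not-adjacent : ¬ T (adj G v x)
    x-not-adjacent vx with earlier zero (T⇒≡true vx)
    ... | _ , () , _
    earlier′ : LocalMin v σ
    earlier′ i vσi with earlier (suc i) vσi
    ... | zero  , _            , x≡v  = contradiction (trans (sym (≡⇒eqFin x≡v)) x≟v) true≢false
    ... | suc j , ℕ.s≤s j<i , σj≡v = j , j<i , σj≡v

  module _ {k} {J : Subset n} {x : Fin n} {σ : Vec (Fin n) k} where

    localMins-∷-∈ : Independent G J → x ∈ J → localMins J (x ∷ σ) ≡ localMins (J ∖ x) σ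
    localMins-∷-∈ ind x∈J = allFin?-cong pointwise
      where
      pointwise : ∀ v → (not (memb v J) ∨ (eqFin x v ∨ (not (adj G v x) ∧ localMin v σ)))
                        ≡ (not (memb v (J ∖ x)) ∨ localMin v σ)
      pointwise v rewrite memb-∖ J x v with memb v J in v∈J | eqFin x v
      ... | false | _     = refl
      ... | true  | true  = refl
      ... | true  | false rewrite ind v x (memb⇒∈ v∈J) x∈J = refl

    localMins-∷-nbhd : memb x J ≡ false → nbhd J x ≡ true → localMins J (x ∷ σ) ≡ false
    localMins-∷-nbhd x∉J x∈NJ with nbhd⁻ x∈NJ
    ... | v , v∈J , vx = ¬T⇒≡false λ t → subst T v-not-first (Equivalence.to T-every t v v∈J)
      where
      x≢v : x ≢ v
      x≢v refl = true≢false (trans (sym (∈⇒memb v∈J)) x∉J)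
      v-not-first : localMin v (x ∷ σ) ≡ false
      v-not-first rewrite ≢⇒eqFin x≢v | vx = refl

    localMins-∷-∉ : memb x J ≡ false → nbhd J x ≡ false → localMins J (x ∷ σ) ≡ localMins J σ
    localMins-∷-∉ x∉J x∉NJ = allFin?-cong pointwise
      where
      x≢v : ∀ {v} → memb v J ≡ true → x ≢ v
      x≢v v∈J refl = true≢false (trans (sym v∈J) x∉J)
      v≁x : ∀ {v} → memb v J ≡ true → adj G v x ≡ false
      v≁x v∈J = ¬T⇒≡false λ vx → true≢false (trans (sym (nbhd⁺ (memb⇒∈ v∈J) (T⇒≡true vx))) x∉NJ)
      pointwise : ∀ v → (not (memb v J) ∨ (eqFin x v ∨ (not (adj G v x) ∧ localMin v σ)))
                        ≡ (not (memb v J) ∨ localMin v σ)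
      pointwise v with memb v J in v∈J
      ... | false = refl
      ... | true rewrite ≢⇒eqFin (x≢v v∈J) | v≁x v∈J = refl

  fromℕ-nbhdSize : ∀ J → fromℕ (nbhdSize G J) ≡ ∑ (𝟙 ∘ nbhd J) (allFin n)
  fromℕ-nbhdSize J = fromℕ-count (nbhd J) (allFin n)

  n-a≡∣J∣+∣NJ∣ : ∀ J → fromℕ n - a G J ≡ fromℕ ∣ J ∣ + fromℕ (nbhdSize G J)
  n-a≡∣J∣+∣NJ∣ J = lemma (fromℕ n) (fromℕ ∣ J ∣) (fromℕ (nbhdSize G J))
    where
    lemma : ∀ N j s → N - (N - j - s) ≡ j + s
    lemma = solve 3 (λ N j s → N :- (N :- j :- s) := j :+ s) refl

  b-rec : ∀ J → ∑ (λ x → 𝟙 (memb x J) * b G (J ∖ x)) (allFin n) ≡ (fromℕ ∣ J ∣ + fromℕ (nbhdSize G J)) * b G J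
  b-rec J = unfold ∣ J ∣ refl
    where
    unfold : ∀ k → ∣ J ∣ ≡ k →
             ∑ (λ x → 𝟙 (memb x J) * b G (J ∖ x)) (allFin n) ≡ (fromℕ k + fromℕ (nbhdSize G J)) * bAux G k J
    unfold zero ∣J∣≡0 = trans (∑-zero (λ x → trans (cong (λ c → 𝟙 c * b G (J ∖ x)) (x∉J x)) (ℚₚ.*-zeroˡ (b G (J ∖ x)))) (allFin n))
                              (sym (cong (λ s → (0ℚ + s) * 1ℚ) ∣NJ∣≡0))
      where
      x∉J : ∀ x → memb x J ≡ false
      x∉J x = ¬T⇒≡false (∣p∣≡0⇒x∉p ∣J∣≡0 x ∘ toWitness)
      ∣NJ∣≡0 : fromℕ (nbhdSize G J) ≡ 0ℚ
      ∣NJ∣≡0 = trans (fromℕ-nbhdSize J) (∑-zero (λ u → cong 𝟙 (¬T⇒≡false λ t →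
        let v , v∈J , _ = nbhd⁻ (T⇒≡true t) in ∣p∣≡0⇒x∉p ∣J∣≡0 v v∈J)) (allFin n))
    unfold (suc k) ∣J∣≡1+k with nonempty? J
    ... | no J-empty = contradiction (trans (cong ∣_∣ (sym (Empty-unique J-empty))) ∣J∣≡1+k) (ℕₚ.0≢1+n ∘ trans (sym (∣⊥∣≡0 n)))
    ... | yes _ = begin
      ∑ (λ x → 𝟙 (memb x J) * b G (J ∖ x)) (allFin n)         ≡⟨ ∑-cong pointwise (allFin n) ⟩
      X                                                       ≡⟨ sym (*-÷'-inverse X s≢0) ⟩
      s * (X ÷' s)                                            ≡⟨ cong (λ d → s * (X ÷' d)) (sym n-a≡s) ⟩
      s * (X ÷' (fromℕ n - a G J))                            ∎
      where
      open ≡-Reasoning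
      s : ℚ
      s = fromℕ (suc k) + fromℕ (nbhdSize G J)
      X : ℚ
      X = sumFin (λ v → if memb v J then bAux G k (J ∖ v) else 0ℚ)
      s≢0 : s ≢ 0ℚ
      s≢0 = fromℕ-≢0 {suc k ℕ.+ nbhdSize G J} (λ ()) ∘ trans (fromℕ-+ (suc k) (nbhdSize G J))
      n-a≡s : fromℕ n - a G J ≡ s
      n-a≡s = trans (n-a≡∣J∣+∣NJ∣ J) (cong (λ j → fromℕ j + fromℕ (nbhdSize G J)) ∣J∣≡1+k)
      pointwise : ∀ x → 𝟙 (memb x J) * b G (J ∖ x) ≡ (if memb x J then bAux G k (J ∖ x) else 0ℚ)
      pointwise x with memb x J in x∈J
      ... | true  = trans (ℚₚ.*-identityˡ _) (cong (λ j → bAux G j (J ∖ x))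
                      (x∈p∧∣p∣≡1+k⇒∣p-x∣≡k (memb⇒∈ x∈J) ∣J∣≡1+k))
      ... | false = ℚₚ.*-zeroˡ (b G (J ∖ x))

  ∑-outside-N[J] : ∀ {J A} → Independent G J → N[ J ]⊆ A →
              ∑ (λ x → 𝟙 (memb x A ∧ not (memb x J ∨ nbhd J x))) (allFin n) + (fromℕ ∣ J ∣ + fromℕ (nbhdSize G J))
              ≡ fromℕ ∣ A ∣
  ∑-outside-N[J] {J} {A} ind N[J]⊆A = begin
    ∑ outside (allFin n) + (fromℕ ∣ J ∣ + fromℕ (nbhdSize G J))
      ≡⟨ cong (∑ outside (allFin n) +_) (trans (cong₂ _+_ (fromℕ-∣∣ J) (fromℕ-nbhdSize J))
                                               (sym (∑-+ (𝟙 ∘ (λ x → memb x J)) (𝟙 ∘ nbhd J) (allFin n)))) ⟩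
    ∑ outside (allFin n) + ∑ (λ x → 𝟙 (memb x J) + 𝟙 (nbhd J x)) (allFin n)
      ≡⟨ sym (∑-+ outside _ (allFin n)) ⟩
    ∑ (λ x → outside x + (𝟙 (memb x J) + 𝟙 (nbhd J x))) (allFin n)
      ≡⟨ ∑-cong partition (allFin n) ⟩
    ∑ (λ x → 𝟙 (memb x A)) (allFin n)
      ≡⟨ sym (fromℕ-∣∣ A) ⟩
    fromℕ ∣ A ∣ ∎
    where
    open ≡-Reasoning
    outside : Fin n → ℚ
    outside x = 𝟙 (memb x A ∧ not (memb x J ∨ nbhd J x))
    partition : ∀ x → outside x + (𝟙 (memb x J) + 𝟙 (nbhd J x)) ≡ 𝟙 (memb x A)
    partition x with memb x J in x∈J | nbhd J x in x∈NJ | memb x A in x∈A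
    ... | true  | true  | _     = contradiction (trans (sym x∈NJ) (Independent⇒∉nbhd ind (memb⇒∈ x∈J))) true≢false
    ... | true  | false | true  = refl
    ... | false | true  | true  = refl
    ... | false | false | true  = refl
    ... | false | false | false = refl
    ... | true  | false | false = contradiction (trans (sym (∈⇒memb (N[J]⊆A x (≡true⇒T (cong₂ _∨_ x∈J x∈NJ))))) x∈A) true≢false
    ... | false | true  | false = contradiction (trans (sym (∈⇒memb (N[J]⊆A x (≡true⇒T (cong₂ _∨_ x∈J x∈NJ))))) x∈A) true≢false

  ∑-outside-N[J]-⊤ : ∀ {J} → Independent G J → ∑ (λ x → 𝟙 (not (memb x J ∨ nbhd J x))) (allFin n) ≡ a G J
  ∑-outside-N[J]-⊤ {J} ind = begin
    O                                                  ≡⟨ lemma O j s ⟩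
    ((O + (j + s)) - j) - s                            ≡⟨ cong (λ c → (c - j) - s) (trans O≡O⊤ (∑-outside-N[J] ind (λ _ _ → ∈⊤))) ⟩
    (fromℕ ∣ ⊤ {n} ∣ - j) - s                          ≡⟨ cong (λ c → (fromℕ c - j) - s) (∣⊤∣≡n n) ⟩
    a G J                                              ∎
    where
    open ≡-Reasoning
    j s O : ℚ
    j = fromℕ ∣ J ∣
    s = fromℕ (nbhdSize G J)
    O = ∑ (λ x → 𝟙 (not (memb x J ∨ nbhd J x))) (allFin n)
    O≡O⊤ : O + (j + s) ≡ ∑ (λ x → 𝟙 (memb x ⊤ ∧ not (memb x J ∨ nbhd J x))) (allFin n) + (j + s)
    O≡O⊤ = cong (_+ (j + s)) (∑-cong (λ x → cong (λ c → 𝟙 (c ∧ not (memb x J ∨ nbhd J x))) (sym (∈⇒memb {v = x} {J = ⊤} ∈⊤))) (allFin n))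
    lemma : ∀ o j s → o ≡ ((o + (j + s)) - j) - s
    lemma = solve 3 (λ o j s → o := ((o :+ (j :+ s)) :- j) :- s) refl

  #arrangements-localMins : ∀ k {A J} → ∣ A ∣ ≡ k → Independent G J → N[ J ]⊆ A →
                            #arrangements k A (localMins J) ≡ b G J * fromℕ (k !)

  #arrangements-localMins-from : ∀ k {A J x} → ∣ A ∣ ≡ suc k → Independent G J → N[ J ]⊆ A → x ∈ A →
                                 #arrangements k (A ∖ x) (localMins J ∘ (x ∷_))
                                 ≡ (if memb x J then b G (J ∖ x) else 𝟙 (not (nbhd J x)) * b G J) * fromℕ (k !)

  #arrangements-localMins zero {A} {J} ∣A∣≡0 ind N[J]⊆A =
    trans (cong (λ c → 1ℚ * 𝟙 c + 0ℚ) no-constraint) (sym (cong (_* 1ℚ) (b-empty ∣J∣≡0)))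
    where
    no-constraint : localMins J [] ≡ true
    no-constraint = T⇒≡true (Equivalence.from (T-every {J = J} {λ v → localMin v []}) (λ _ _ → _))
    ∣J∣≡0 : ∣ J ∣ ≡ 0
    ∣J∣≡0 = ℕₚ.n≤0⇒n≡0 (subst (∣ J ∣ ℕ.≤_) ∣A∣≡0
              (p⊆q⇒∣p∣≤∣q∣ λ {u} u∈J → N[J]⊆A u (Equivalence.from (T-∨ {memb u J}) (inj₁ (fromWitness u∈J)))))
    b-empty : ∣ J ∣ ≡ 0 → b G J ≡ 1ℚ
    b-empty = cong (λ k → bAux G k J)
  #arrangements-localMins (suc k) {A} {J} ∣A∣≡1+k ind N[J]⊆A = begin
    #arrangements (suc k) A (localMins J)
      ≡⟨ #arrangements-∷ A (localMins J) ⟩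
    ∑ (λ x → 𝟙 (memb x A) * #arrangements k (A ∖ x) (localMins J ∘ (x ∷_))) (allFin n)
      ≡⟨ ∑-cong first-vertex (allFin n) ⟩
    ∑ (λ x → weighted x * K) (allFin n)
      ≡⟨ ∑-*ʳ K weighted (allFin n) ⟩
    ∑ weighted (allFin n) * K
      ≡⟨ cong (_* K) (trans (∑-+ (λ x → 𝟙 (memb x J) * b G (J ∖ x)) (λ x → outside x * b G J) (allFin n))
                            (cong (∑ (λ x → 𝟙 (memb x J) * b G (J ∖ x)) (allFin n) +_) (∑-*ʳ (b G J) outside (allFin n)))) ⟩
    (∑ (λ x → 𝟙 (memb x J) * b G (J ∖ x)) (allFin n) + O * b G J) * K
      ≡⟨ cong (λ c → (c + O * b G J) * K) (b-rec J) ⟩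
    (S * b G J + O * b G J) * K
      ≡⟨ rearrange S (b G J) O K ⟩
    b G J * ((O + S) * K)
      ≡⟨ cong (λ c → b G J * (c * K)) (trans (∑-outside-N[J] ind N[J]⊆A) (cong fromℕ ∣A∣≡1+k)) ⟩
    b G J * (fromℕ (suc k) * K)
      ≡⟨ cong (b G J *_) (sym (fromℕ-* (suc k) (k !))) ⟩
    b G J * fromℕ (suc k !) ∎
    where
    open ≡-Reasoning
    K S : ℚ
    K = fromℕ (k !)
    S = fromℕ ∣ J ∣ + fromℕ (nbhdSize G J)
    outside : Fin n → ℚ
    outside x = 𝟙 (memb x A ∧ not (memb x J ∨ nbhd J x))
    O : ℚ
    O = ∑ outside (allFin n)
    weighted : Fin n → ℚ
    weighted x = 𝟙 (memb x J) * b G (J ∖ x) + outside x * b G J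
    rearrange : ∀ s c o d → (s * c + o * c) * d ≡ c * ((o + s) * d)
    rearrange = solve 4 (λ s c o d → (s :* c :+ o :* c) :* d := c :* ((o :+ s) :* d)) refl
    ∉A⇒∉J : ∀ {x} → memb x A ≡ false → memb x J ≡ false
    ∉A⇒∉J {x} x∉A = ¬T⇒≡false λ t → true≢false (trans (sym (∈⇒memb (N[J]⊆A x (Equivalence.from (T-∨ {memb x J}) (inj₁ t))))) x∉A)
    first-vertex : ∀ x → 𝟙 (memb x A) * #arrangements k (A ∖ x) (localMins J ∘ (x ∷_)) ≡ weighted x * K
    first-vertex x with memb x A in x∈A
    ... | true  = trans (ℚₚ.*-identityˡ _) (trans (#arrangements-localMins-from k ∣A∣≡1+k ind N[J]⊆A (memb⇒∈ x∈A))
                                                  (cong (_* K) (weights (memb x J) (nbhd J x))))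
      where
      weights : ∀ j ν → (if j then b G (J ∖ x) else 𝟙 (not ν) * b G J) ≡ 𝟙 j * b G (J ∖ x) + 𝟙 (not (j ∨ ν)) * b G J
      weights true  ν = solve 2 (λ b′ b → b′ := con 1ℚ :* b′ :+ con 0ℚ :* b) refl (b G (J ∖ x)) (b G J)
      weights false ν = solve 3 (λ c b′ b → c :* b := con 0ℚ :* b′ :+ c :* b) refl (𝟙 (not ν)) (b G (J ∖ x)) (b G J)
    ... | false rewrite ∉A⇒∉J x∈A = solve 4 (λ f b′ b k → con 0ℚ :* f := (con 0ℚ :* b′ :+ con 0ℚ :* b) :* k) refl
                                      (#arrangements k (A ∖ x) (localMins J ∘ (x ∷_))) (b G (J ∖ x)) (b G J) K

  #arrangements-localMins-from k {A} {J} {x} ∣A∣≡1+k ind N[J]⊆A x∈A with memb x J in x∈J | nbhd J x in x∈NJ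
  ... | true  | _     = begin
    #arrangements k (A ∖ x) (localMins J ∘ (x ∷_))
      ≡⟨ #arrangements-cong {k = k} (A ∖ x) _ (localMins (J ∖ x)) (λ σ _ → localMins-∷-∈ {σ = σ} ind (memb⇒∈ x∈J)) ⟩
    #arrangements k (A ∖ x) (localMins (J ∖ x))
      ≡⟨ #arrangements-localMins k (x∈p∧∣p∣≡1+k⇒∣p-x∣≡k x∈A ∣A∣≡1+k) (Independent-∖ x ind) (N[]⊆-∖-∈ ind (memb⇒∈ x∈J) N[J]⊆A) ⟩
    b G (J ∖ x) * fromℕ (k !) ∎
    where open ≡-Reasoning
  ... | false | true  = begin
    #arrangements k (A ∖ x) (localMins J ∘ (x ∷_))
      ≡⟨ #arrangements-none {k = k} (A ∖ x) _ (λ σ → localMins-∷-nbhd {σ = σ} x∈J x∈NJ) ⟩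
    0ℚ
      ≡⟨ solve 2 (λ b k → con 0ℚ := (con 0ℚ :* b) :* k) refl (b G J) (fromℕ (k !)) ⟩
    (0ℚ * b G J) * fromℕ (k !) ∎
    where open ≡-Reasoning
  ... | false | false = begin
    #arrangements k (A ∖ x) (localMins J ∘ (x ∷_))
      ≡⟨ #arrangements-cong {k = k} (A ∖ x) _ (localMins J) (λ σ _ → localMins-∷-∉ {σ = σ} x∈J x∈NJ) ⟩
    #arrangements k (A ∖ x) (localMins J)
      ≡⟨ #arrangements-localMins k (x∈p∧∣p∣≡1+k⇒∣p-x∣≡k x∈A ∣A∣≡1+k) ind (N[]⊆-∖-∉ (cong₂ _∨_ x∈J x∈NJ) N[J]⊆A) ⟩
    b G J * fromℕ (k !)
      ≡⟨ cong (_* fromℕ (k !)) (sym (ℚₚ.*-identityˡ (b G J))) ⟩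
    (1ℚ * b G J) * fromℕ (k !) ∎
    where open ≡-Reasoning

-- σ lists the vertices by increasing label: π = inverse σ gives σ i the label i + 1 (stored as i)

module _ {m} (G : Graph (suc m)) {σ : Vec (Fin (suc m)) (suc m)} (σ-inj : Injective _≡_ _≡_ (lookup σ)) where

  private
    π : Vec (Fin (suc m)) (suc m)
    π = inverse σ
    σ∘π≗id : ∀ v → lookup σ (lookup π v) ≡ v
    σ∘π≗id = lookup-inverse {σ = σ} σ-inj
    π∘σ≗id : ∀ i → lookup π (lookup σ i) ≡ i
    π∘σ≗id = inverse-lookup {σ = σ} σ-inj

  labelOne≡first : ∀ v → ⌊ toℕ (lookup π v) ℕ.≟ 0 ⌋ ≡ eqFin (lookup σ zero) v
  labelOne≡first v = T-ext
    (λ t → fromWitness (trans (cong (lookup σ) (sym (Finₚ.toℕ-injective {j = zero} (toWitness t)))) (σ∘π≗id v)))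
    (λ t → fromWitness (cong toℕ (trans (cong (lookup π) (sym (toWitness t))) (π∘σ≗id zero))))

  smallerThanNeighbours≡localMin : ∀ v →
    allFin? (λ u → not (adj G v u) ∨ ltFin (lookup π v) (lookup π u)) ≡ localMin G v σ
  smallerThanNeighbours≡localMin v = T-ext
    (λ t → localMin⁺ G v σ λ i vσi →
       let πv<πσi = toWitness (Equivalence.to (T-implication {adj G v (lookup σ i)})
                                 (Equivalence.to T-allFin? t (lookup σ i)) (≡true⇒T vσi))
       in lookup π v , subst (lookup π v Fin.<_) (π∘σ≗id i) πv<πσi , σ∘π≗id v)
    (λ t → Equivalence.from T-allFin? λ u → Equivalence.from (T-implication {adj G v u}) λ vu →
       let j , j<πu , σj≡v = localMin⁻ G v σ t (lookup π u) (trans (cong (adj G v) (σ∘π≗id u)) (T⇒≡true vu))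
       in fromWitness (subst (Fin._< lookup π u) (trans (sym (π∘σ≗id j)) (cong (lookup π) σj≡v)) j<πu))

  B-inverse : ∀ v → B G v π ≡ not (eqFin (lookup σ zero) v) ∧ localMin G v σ
  B-inverse v = cong₂ (λ c d → not c ∧ d) (labelOne≡first v) (smallerThanNeighbours≡localMin v)

  BJ-inverse : ∀ J → BJ G J π ≡ not (memb (lookup σ zero) J) ∧ localMins G J σ
  BJ-inverse J = trans (allFin?-cong (λ v → cong (not (memb v J) ∨_) (B-inverse v))) (every-≢-∧ J (lookup σ zero) (λ v → localMin G v σ))

#arrangements-BJ : ∀ {m} (G : Graph (suc m)) {J} → Independent G J →
                   #arrangements (suc m) ⊤ (BJ G J ∘ inverse) ≡ a G J * b G J * fromℕ (m !)
#arrangements-BJ {m} G {J} ind = begin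
  #arrangements (suc m) ⊤ (BJ G J ∘ inverse)
    ≡⟨ #arrangements-cong {k = suc m} ⊤ (BJ G J ∘ inverse) (λ σ → not (memb (lookup σ zero) J) ∧ localMins G J σ)
                          (λ σ σ-distinct → BJ-inverse G {σ} (proj₂ (Equivalence.to (T-distinctIn σ) σ-distinct)) J) ⟩
  #arrangements (suc m) ⊤ (λ σ → not (memb (lookup σ zero) J) ∧ localMins G J σ)
    ≡⟨ #arrangements-∷ {k = m} ⊤ (λ σ → not (memb (lookup σ zero) J) ∧ localMins G J σ) ⟩
  ∑ (λ x → 𝟙 (memb x ⊤) * #arrangements m (⊤ ∖ x) (λ σ → not (memb x J) ∧ localMins G J (x ∷ σ))) (allFin (suc m))
    ≡⟨ ∑-cong first-vertex (allFin (suc m)) ⟩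
  ∑ (λ x → 𝟙 (not (memb x J ∨ nbhd G J x)) * (b G J * K)) (allFin (suc m))
    ≡⟨ ∑-*ʳ (b G J * K) (λ x → 𝟙 (not (memb x J ∨ nbhd G J x))) (allFin (suc m)) ⟩
  ∑ (λ x → 𝟙 (not (memb x J ∨ nbhd G J x))) (allFin (suc m)) * (b G J * K)
    ≡⟨ cong (_* (b G J * K)) (∑-outside-N[J]-⊤ G ind) ⟩
  a G J * (b G J * K)
    ≡⟨ sym (ℚₚ.*-assoc (a G J) (b G J) K) ⟩
  a G J * b G J * K ∎
  where
  open ≡-Reasoning
  K : ℚ
  K = fromℕ (m !)
  first-vertex : ∀ x → 𝟙 (memb x ⊤) * #arrangements m (⊤ ∖ x) (λ σ → not (memb x J) ∧ localMins G J (x ∷ σ))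
                       ≡ 𝟙 (not (memb x J ∨ nbhd G J x)) * (b G J * K)
  first-vertex x rewrite ∈⇒memb {v = x} {J = ⊤} ∈⊤ = begin
    1ℚ * #arrangements m (⊤ ∖ x) (λ σ → not (memb x J) ∧ localMins G J (x ∷ σ))
      ≡⟨ ℚₚ.*-identityˡ _ ⟩
    #arrangements m (⊤ ∖ x) (λ σ → not (memb x J) ∧ localMins G J (x ∷ σ))
      ≡⟨ #arrangements-∧ {k = m} (⊤ ∖ x) (not (memb x J)) (localMins G J ∘ (x ∷_)) ⟩
    𝟙 (not (memb x J)) * #arrangements m (⊤ ∖ x) (localMins G J ∘ (x ∷_))
      ≡⟨ cong (𝟙 (not (memb x J)) *_) (#arrangements-localMins-from G m (∣⊤∣≡n (suc m)) ind (λ _ _ → ∈⊤) ∈⊤) ⟩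
    𝟙 (not (memb x J)) * ((if memb x J then b G (J ∖ x) else 𝟙 (not (nbhd G J x)) * b G J) * K)
      ≡⟨ only-outside (memb x J) (nbhd G J x) ⟩
    𝟙 (not (memb x J ∨ nbhd G J x)) * (b G J * K) ∎
    where
    only-outside : ∀ j ν → 𝟙 (not j) * ((if j then b G (J ∖ x) else 𝟙 (not ν) * b G J) * K)
                           ≡ 𝟙 (not (j ∨ ν)) * (b G J * K)
    only-outside true  ν = trans (ℚₚ.*-zeroˡ (b G (J ∖ x) * K)) (sym (ℚₚ.*-zeroˡ (b G J * K)))
    only-outside false ν = trans (ℚₚ.*-identityˡ _) (ℚₚ.*-assoc (𝟙 (not ν)) (b G J) K)

incExcCoeff : ∀ {n} → Subset n → Subset n → ℚ
incExcCoeff J T = if ⌊ T ⊆? J ⌋ then signQ ∣ T ∣ else 0ℚ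

incExcCoeff-∷ : ∀ {n} j t (J T : Subset n) → incExcCoeff (j ∷ J) (t ∷ T) ≡ (if t then - 𝟙 j else 1ℚ) * incExcCoeff J T
incExcCoeff-∷ j     false J T with T ⊆? J
... | yes _ = sym (ℚₚ.*-identityˡ _)
... | no  _ = sym (ℚₚ.*-identityˡ _)
incExcCoeff-∷ false true  J T = sym (ℚₚ.*-zeroˡ (incExcCoeff J T))
incExcCoeff-∷ true  true  J T with T ⊆? J
... | yes _ = solve 1 (λ s → :- s := (:- con 1ℚ) :* s) refl (signQ ∣ T ∣)
... | no  _ = sym (ℚₚ.*-zeroʳ (- 1ℚ))

inclusion-exclusion : ∀ {n} (J : Subset n) (g : Fin n → Bool) →
                      ∑ (λ T → incExcCoeff J T * 𝟙 (every T g)) (allSubsets n) ≡ 𝟙 (every J (not ∘ g))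
inclusion-exclusion []      g = refl
inclusion-exclusion {suc n} (j ∷ J) g = begin
  ∑ (λ T → incExcCoeff (j ∷ J) T * 𝟙 (every T g)) (allSubsets (suc n))
    ≡⟨ ∑-concatMap (λ T → incExcCoeff (j ∷ J) T * 𝟙 (every T g)) (λ T → (true ∷ T) ∷ (false ∷ T) ∷ []) (allSubsets n) ⟩
  ∑ (λ T → incExcCoeff (j ∷ J) (true ∷ T) * 𝟙 (every (true ∷ T) g)
           + (incExcCoeff (j ∷ J) (false ∷ T) * 𝟙 (every (false ∷ T) g) + 0ℚ)) (allSubsets n)
    ≡⟨ ∑-cong pair (allSubsets n) ⟩
  ∑ (λ T → 𝟙 (not (j ∧ g zero)) * (incExcCoeff J T * 𝟙 (every T (g ∘ suc)))) (allSubsets n)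
    ≡⟨ ∑-*ˡ (𝟙 (not (j ∧ g zero))) (λ T → incExcCoeff J T * 𝟙 (every T (g ∘ suc))) (allSubsets n) ⟩
  𝟙 (not (j ∧ g zero)) * ∑ (λ T → incExcCoeff J T * 𝟙 (every T (g ∘ suc))) (allSubsets n)
    ≡⟨ cong (𝟙 (not (j ∧ g zero)) *_) (inclusion-exclusion J (g ∘ suc)) ⟩
  𝟙 (not (j ∧ g zero)) * 𝟙 (every J (not ∘ g ∘ suc))
    ≡⟨ sym (𝟙-∧ (not (j ∧ g zero)) (every J (not ∘ g ∘ suc))) ⟩
  𝟙 (not (j ∧ g zero) ∧ every J (not ∘ g ∘ suc))
    ≡⟨ cong 𝟙 (sym (trans (every-∷ j J (not ∘ g)) (cong (_∧ every J (not ∘ g ∘ suc)) (deMorgan j (g zero))))) ⟩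
  𝟙 (every (j ∷ J) (not ∘ g)) ∎
  where
  open ≡-Reasoning
  deMorgan : ∀ a b → not a ∨ not b ≡ not (a ∧ b)
  deMorgan true  b = refl
  deMorgan false b = refl
  𝟙-not-∧ : ∀ a b → 𝟙 (not (a ∧ b)) ≡ 1ℚ - 𝟙 a * 𝟙 b
  𝟙-not-∧ true  true  = refl
  𝟙-not-∧ true  false = refl
  𝟙-not-∧ false true  = refl
  𝟙-not-∧ false false = refl
  pair : ∀ T → incExcCoeff (j ∷ J) (true ∷ T) * 𝟙 (every (true ∷ T) g)
               + (incExcCoeff (j ∷ J) (false ∷ T) * 𝟙 (every (false ∷ T) g) + 0ℚ)
             ≡ 𝟙 (not (j ∧ g zero)) * (incExcCoeff J T * 𝟙 (every T (g ∘ suc)))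
  pair T = begin
    incExcCoeff (j ∷ J) (true ∷ T) * 𝟙 (every (true ∷ T) g) + (incExcCoeff (j ∷ J) (false ∷ T) * 𝟙 (every (false ∷ T) g) + 0ℚ)
      ≡⟨ cong₂ (λ p q → p + (q + 0ℚ))
               (cong₂ _*_ (incExcCoeff-∷ j true J T) (trans (cong 𝟙 (every-∷ true T g)) (𝟙-∧ (g zero) E)))
               (cong₂ _*_ (incExcCoeff-∷ j false J T) (cong 𝟙 (every-∷ false T g))) ⟩
    (- 𝟙 j * c) * (𝟙 (g zero) * 𝟙 E) + ((1ℚ * c) * 𝟙 E + 0ℚ)
      ≡⟨ solve 4 (λ jj gg cc ee → (:- jj :* cc) :* (gg :* ee) :+ ((con 1ℚ :* cc) :* ee :+ con 0ℚ)
                                   := (con 1ℚ :- jj :* gg) :* (cc :* ee)) refl (𝟙 j) (𝟙 (g zero)) c (𝟙 E) ⟩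
    (1ℚ - 𝟙 j * 𝟙 (g zero)) * (c * 𝟙 E)
      ≡⟨ cong (_* (c * 𝟙 E)) (sym (𝟙-not-∧ j (g zero))) ⟩
    𝟙 (not (j ∧ g zero)) * (c * 𝟙 E) ∎
    where
    c : ℚ
    c = incExcCoeff J T
    E : Bool
    E = every T (g ∘ suc)

Pr-as-∑ : ∀ {n} (E : Vec (Fin n) n → Bool) → Pr E ≡ ∑ (𝟙 ∘ E) (Perms n) ÷' fromℕ (length (Perms n))
Pr-as-∑ {n} E = cong (_÷' fromℕ (length (Perms n))) (fromℕ-count E (Perms n))

Pr-as-#arrangements : ∀ {n} (E : Vec (Fin n) n → Bool) → Pr E ≡ #arrangements n ⊤ (E ∘ inverse) ÷' fromℕ (n !)
Pr-as-#arrangements {n} E = trans (Pr-as-∑ E) (cong₂ _÷'_ (∑-Perms (𝟙 ∘ E))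
  (trans (fromℕ-length (Perms n)) (trans (∑-Perms {n} (λ _ → 1ℚ)) (#arrangements-all n {⊤} (∣⊤∣≡n n)))))

Pr-BJ : ∀ {m} (G : Graph (suc m)) {J} → Independent G J → Pr (BJ G J) ≡ (a G J * b G J) ÷' fromℕ (suc m)
Pr-BJ {m} G {J} ind = begin
  Pr (BJ G J)                                                     ≡⟨ Pr-as-#arrangements (BJ G J) ⟩
  #arrangements (suc m) ⊤ (BJ G J ∘ inverse) ÷' fromℕ (suc m !)   ≡⟨ cong₂ _÷'_ (#arrangements-BJ G ind) (fromℕ-* (suc m) (m !)) ⟩
  (a G J * b G J * fromℕ (m !)) ÷' (fromℕ (suc m) * fromℕ (m !))  ≡⟨ ÷'-cancelʳ (a G J * b G J) (fromℕ (suc m)) (fromℕ (m !)) n!≢0 ⟩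
  (a G J * b G J) ÷' fromℕ (suc m)                                ∎
  where
  open ≡-Reasoning
  n!≢0 : fromℕ (suc m) * fromℕ (m !) ≢ 0ℚ
  n!≢0 = fromℕ-≢0 (ℕₚ.<⇒≢ (ℕₚ.1≤n! (suc m)) ∘ sym) ∘ trans (fromℕ-* (suc m) (m !))

inclExcl≡Pr-BJ : ∀ {n} (G : Graph n) J → inclExcl G J ≡ Pr (BJ G J)
inclExcl≡Pr-BJ {n} G J = begin
  inclExcl G J
    ≡⟨ ∑-cong term (allSubsets n) ⟩
  ∑ (λ T → (incExcCoeff J T * X (GJ G T)) ÷' D) (allSubsets n)
    ≡⟨ ∑-÷' (λ T → incExcCoeff J T * X (GJ G T)) D (allSubsets n) ⟩
  ∑ (λ T → incExcCoeff J T * X (GJ G T)) (allSubsets n) ÷' D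
    ≡⟨ cong (_÷' D) collapse ⟩
  X (BJ G J) ÷' D
    ≡⟨ sym (Pr-as-∑ (BJ G J)) ⟩
  Pr (BJ G J) ∎
  where
  open ≡-Reasoning
  D : ℚ
  D = fromℕ (length (Perms n))
  X : (Vec (Fin n) n → Bool) → ℚ
  X E = ∑ (𝟙 ∘ E) (Perms n)
  term : ∀ T → (if ⌊ T ⊆? J ⌋ then signQ ∣ T ∣ * Pr (GJ G T) else 0ℚ) ≡ (incExcCoeff J T * X (GJ G T)) ÷' D
  term T = trans (if-* ⌊ T ⊆? J ⌋)
                 (trans (cong (incExcCoeff J T *_) (Pr-as-∑ (GJ G T))) (*-÷'-assoc (incExcCoeff J T) (X (GJ G T)) D))
    where
    if-* : ∀ c → (if c then signQ ∣ T ∣ * Pr (GJ G T) else 0ℚ) ≡ (if c then signQ ∣ T ∣ else 0ℚ) * Pr (GJ G T)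
    if-* true  = refl
    if-* false = sym (ℚₚ.*-zeroˡ (Pr (GJ G T)))
  collapse : ∑ (λ T → incExcCoeff J T * X (GJ G T)) (allSubsets n) ≡ X (BJ G J)
  collapse = begin
    ∑ (λ T → incExcCoeff J T * X (GJ G T)) (allSubsets n)
      ≡⟨ ∑-cong (λ T → sym (∑-*ˡ (incExcCoeff J T) (𝟙 ∘ GJ G T) (Perms n))) (allSubsets n) ⟩
    ∑ (λ T → ∑ (λ π → incExcCoeff J T * 𝟙 (GJ G T π)) (Perms n)) (allSubsets n)
      ≡⟨ ∑-swap (λ T π → incExcCoeff J T * 𝟙 (GJ G T π)) (allSubsets n) (Perms n) ⟩
    ∑ (λ π → ∑ (λ T → incExcCoeff J T * 𝟙 (GJ G T π)) (allSubsets n)) (Perms n)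
      ≡⟨ ∑-cong (λ π → trans (inclusion-exclusion J (λ v → Gd G v π))
                             (cong 𝟙 (allFin?-cong λ v → cong (not (memb v J) ∨_) (not-involutive (B G v π))))) (Perms n) ⟩
    X (BJ G J) ∎

-- connectedness is only needed to exclude n = 0
corollary3p2 : (n : ℕ) (G : Graph n) → Connected G →
    (J : Subset n) → Independent G J →
    (Pr (BJ G J) ≡ (a G J * b G J) ÷' fromℕ n) × ((a G J * b G J) ÷' fromℕ n ≡ inclExcl G J)
corollary3p2 zero    G (() , _) J indep
corollary3p2 (suc m) G _        J indep =
  Pr-BJ G indep , trans (sym (Pr-BJ G indep)) (sym (inclExcl≡Pr-BJ G J))
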